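{- For every snake graph $\mathcal{G}$, the orientation $\mathcal{P}(\mathcal{G})$ is a pfaffian orientation, i.e. $|\operatorname{pff}(B_{\mathcal{P}(\mathcal{G})}(1))|$ equals the number of perfect matchings of $\mathcal{G}$.
   Context: A tile is a square drawn in the plane (with axis-parallel sides), viewed as a graph with 4 vertices and 4 edges. A snake graph $\mathcal{G}$ with $d\geq 1$ tiles is the plane graph obtained from a sequence of tiles $G_1,\dots,G_d$ where for each $1\leq i\leq d-1$, tile $G_{i+1}$ is placed either directly to the right of $G_i$ (so the right edge of $G_i$ is identified with the left edge of $G_{i+1}$) or directly on top of $G_i$ (so the top edge of $G_i$ is identified with the bottom edge of $G_{i+1}$). Edges lying on the unbounded face are boundary edges; the others (the shared edges) are internal. The orientation $\mathcal{P}(\mathcal{G})$ is defined by: (1) orient the boundary edges cyclically counterclockwise around the boundary; (2) orient every internal vertical edge from bottom to top and every internal horizontal edge from right to left; (3) then reverse the orientation of the left edge of $G_1$. For an oriented simple graph with vertices $v_1,\dots,v_n$, $B(1)=(b_{i,j})$ is the matrix with $b_{i,j}=1$ if there is an arrow $v_i\to v_j$, $b_{i,j}=-1$ if there is an arrow $v_j\to v_i$, and $0$ otherwise. For a skew-symmetric matrix $C=(c_{i,j})$ of size $2k$, $\operatorname{pff}(C)=\sum_P \operatorname{sgn}(\sigma_P)\,c_{i_1,j_1}\cdots c_{i_k,j_k}$, summed over all partitions $P=\{\{i_1,j_1\},\dots,\{i_k,j_k\}\}$ of $\{1,\dots,2k\}$ into pairs, where $\sigma_P$ is the permutation $1\mapsto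 i_1,2\mapsto j_1,\dots,2k-1\mapsto i_k,2k\mapsto j_k$. (The absolute value $|\operatorname{pff}(B(1))|$ does not depend on the vertex labeling.) -}

module Defs where

open import Data.Nat using (ℕ; zero; suc; _+_; _<?_; _≥?_)
open import Data.Integer as ℤ using (ℤ; +_; -_)
open import Data.List using (List; []; _∷_; _++_; map; concat; concatMap; filter; length; zip; upTo; foldr)
open import Data.List.Relation.Unary.All using (All)
open import Data.List.Relation.Unary.All.Properties using ()
import Data.List.Relation.Unary.All as All
open import Data.List.Relation.Unary.Any using (any?)
open import Data.Product using (_×_; _,_; proj₁; proj₂)
open import Data.Product.Properties using (≡-dec)
open import Data.Sum using (_⊎_; inj₁; inj₂)
open import Data.Bool using (Bool; true; false; if_then_else_)
open import Relation.Binary.PropositionalEquality using (_≡_)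
open import Relation.Nullary using (Dec; yes; no; does; _×-dec_; _⊎-dec_)
import Data.Nat as ℕ

data Dir : Set where
  right up : Dir

-- A snake graph with d ≥ 1 tiles is given by the list of d - 1 placements
-- (tile G_{i+1} to the right of / on top of G_i).  Tile G_1 has its lower
-- left corner at the origin; unit side length.
SnakeGraph : Set
SnakeGraph = List Dir

Point : Set
Point = ℕ × ℕ

_≟P_ : (p q : Point) → Dec (p ≡ q)
_≟P_ = ≡-dec ℕ._≟_ ℕ._≟_

-- A (geometric, undirected) edge: a unit segment, stored with its
-- lower/left endpoint first.
Seg : Set
Seg = Point × Point

_≟S_ : (s t : Seg) → Dec (s ≡ t)
_≟S_ = ≡-dec _≟P_ _≟P_

Arc : Set
Arc = Point × Point

_≟A_ : (s t : Arc) → Dec (s ≡ t)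
_≟A_ = ≡-dec _≟P_ _≟P_

step : Dir → Point → Point
step right (x , y) = (suc x , y)
step up    (x , y) = (x , suc y)

-- lower-left corners of the tiles G_1, …, G_d
tilesFrom : Point → List Dir → List Point
tilesFrom p []       = p ∷ []
tilesFrom p (d ∷ ds) = p ∷ tilesFrom (step d p) ds

tiles : SnakeGraph → List Point
tiles = tilesFrom (0 , 0)

data Side : Set where
  bot rgt top lft : Side

sides : List Side
sides = bot ∷ rgt ∷ top ∷ lft ∷ []

seg : Point → Side → Seg
seg (x , y) bot = ((x , y) , (suc x , y))
seg (x , y) rgt = ((suc x , y) , (suc x , suc y))
seg (x , y) top = ((x , suc y) , (suc x , suc y))
seg (x , y) lft = ((x , y) , (x , suc y))

ccw : Point → Side → Arc
ccw (x , y) bot = ((x , y) , (suc x , y))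
ccw (x , y) rgt = ((suc x , y) , (suc x , suc y))
ccw (x , y) top = ((suc x , suc y) , (x , suc y))
ccw (x , y) lft = ((x , suc y) , (x , y))

flipArc : Arc → Arc
flipArc (u , v) = (v , u)

tileSides : SnakeGraph → List (Point × Side)
tileSides G = concatMap (λ p → map (λ s → (p , s)) sides) (tiles G)

dedup : {A : Set} → ((a b : A) → Dec (a ≡ b)) → List A → List A
dedup eq [] = []
dedup eq (a ∷ as) with any? (eq a) as
... | yes _ = dedup eq as
... | no  _ = a ∷ dedup eq as

edges : SnakeGraph → List Seg
edges G = dedup _≟S_ (map (λ ps → seg (proj₁ ps) (proj₂ ps)) (tileSides G))

vertices : SnakeGraph → List Point
vertices G = dedup _≟P_ (concatMap (λ e → proj₁ e ∷ proj₂ e ∷ []) (edges G))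

multiplicity : SnakeGraph → Seg → ℕ
multiplicity G e = length (filter (λ ps → seg (proj₁ ps) (proj₂ ps) ≟S e) (tileSides G))

isInternal : SnakeGraph → Seg → Bool
isInternal G e = does (multiplicity G e ≥? 2)

isHorizontal : Seg → Bool
isHorizontal ((x , y) , (x' , y')) = does (y ℕ.≟ y')

-- internal vertical: bottom to top; internal horizontal: right to left
internalArc : Seg → Arc
internalArc (a , b) = if isHorizontal (a , b) then (b , a) else (a , b)

isLeftOfG1 : SnakeGraph → Seg → Bool
isLeftOfG1 G e = does (e ≟S seg (0 , 0) lft)

-- orientation of the side s of the tile at p, following the rules
-- (1) boundary edges counterclockwise (the interior of the snake graph,
--     i.e. that tile, lies to the left), (2) internal edges as above,
-- (3) reverse the left edge of G_1.
arcOf : SnakeGraph → Point → Side → Arc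
arcOf G p s =
  if isInternal G (seg p s) then internalArc (seg p s)
  else (if isLeftOfG1 G (seg p s) then flipArc (ccw p s) else ccw p s)

orientation : SnakeGraph → List Arc
orientation G = dedup _≟A_ (map (λ ps → arcOf G (proj₁ ps) (proj₂ ps)) (tileSides G))

-- The matrix B(1) of an oriented graph, on the vertices (labelled by their
-- position in the list `vertices G`).

bEntry : List Arc → Point → Point → ℤ
bEntry A u v with any? (_≟A_ (u , v)) A
... | yes _ = + 1
... | no  _ with any? (_≟A_ (v , u)) A
...   | yes _ = - (+ 1)
...   | no  _ = + 0

select : {A : Set} → List A → List (A × List A)
select [] = []
select (a ∷ as) = (a , as) ∷ map (λ r → (proj₁ r , a ∷ proj₂ r)) (select as)

-- all partitions of a list into pairs {i , j}, written with i the first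
-- remaining element (every partition occurs exactly once).
-- The first argument is fuel (at least half the length suffices).
pairingsF : {A : Set} → ℕ → List A → List (List (A × A))
pairingsF n [] = [] ∷ []
pairingsF zero (a ∷ as) = []
pairingsF (suc n) (a ∷ as) =
  concatMap (λ r → map ((a , proj₁ r) ∷_) (pairingsF n (proj₂ r))) (select as)

pairings : {A : Set} → List A → List (List (A × A))
pairings xs = pairingsF (length xs) xs

inversions : List ℕ → ℕ
inversions [] = 0
inversions (x ∷ xs) = length (filter (_<? x) xs) + inversions xs

-- sign of the permutation m ↦ (m-th entry of the sequence)
isEven : ℕ → Bool
isEven zero = true
isEven (suc zero) = false
isEven (suc (suc n)) = isEven n

sgn : List ℕ → ℤ
sgn xs = if isEven (inversions xs) then + 1 else - (+ 1)

flatten : {A : Set} → List (A × A) → List A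
flatten [] = []
flatten ((a , b) ∷ ps) = a ∷ b ∷ flatten ps

pff : (n : ℕ) → (ℕ → ℕ → ℤ) → ℤ
pff n C = foldr ℤ._+_ (+ 0)
  (map (λ P → sgn (flatten P) ℤ.* foldr ℤ._*_ (+ 1) (map (λ ij → C (proj₁ ij) (proj₂ ij)) P))
       (pairings (upTo n)))

-- index ↦ vertex (default irrelevant: only used for indices < length)
nth : List Point → ℕ → Point
nth [] _ = (0 , 0)
nth (v ∷ vs) zero = v
nth (v ∷ vs) (suc i) = nth vs i

B1 : SnakeGraph → ℕ → ℕ → ℤ
B1 G i j = bEntry (orientation G) (nth (vertices G) i) (nth (vertices G) j)

sublists : {A : Set} → List A → List (List A)
sublists [] = [] ∷ []
sublists (a ∷ as) = let r = sublists as in map (a ∷_) r ++ r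

incident : (v : Point) → (e : Seg) → Dec ((proj₁ e ≡ v) ⊎ (proj₂ e ≡ v))
incident v e = (proj₁ e ≟P v) ⊎-dec (proj₂ e ≟P v)

degreeIn : List Seg → Point → ℕ
degreeIn M v = length (filter (incident v) M)

IsPerfectMatching : SnakeGraph → List Seg → Set
IsPerfectMatching G M = All (λ v → degreeIn M v ≡ 1) (vertices G)

isPerfectMatching? : (G : SnakeGraph) → (M : List Seg) → Dec (IsPerfectMatching G M)
isPerfectMatching? G M = All.all? (λ v → degreeIn M v ℕ.≟ 1) (vertices G)

numPerfectMatchings : SnakeGraph → ℕ
numPerfectMatchings G = length (filter (isPerfectMatching? G) (sublists (edges G)))

{-# OPTIONS --safe #-}

-- Each tile after G₁ adds two vertices U, W and the three edges
-- UW, aU, bW, where ab is the side it shares with its predecessor. Under 𝒫 the rows of U and W in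
-- B(1) have exactly two non-zero entries, each ±1, so expanding the Pfaffian along them expresses it
-- through the Pfaffians of the previous graph and of the previous graph with a and b deleted. A
-- perfect matching contains either UW or both aU and bW, which gives the same recurrence for the
-- numbers of perfect matchings. Following the three vertex sets that occur, induction shows that
-- each of these Pfaffians is the corresponding matching count up to one common sign ±1. Pfaffians
-- are computed by expansion along the first row, which agrees with the pairing sum of the
-- definition on increasing index lists and only changes sign when the vertices are reordered.

module Submission where

open import Defs
open import Data.Integer using (∣_∣)
open import Data.List using (length)
open import Relation.Binary.PropositionalEquality using (_≡_)
open import Data.List using (reverse)
open import Data.List.Properties using (reverse-involutive)
open import Relation.Binary.PropositionalEquality using (subst)

module Pfaffians where

  open import Data.Nat as ℕ using (ℕ; zero; suc; _≤_; _<_; _<?_; s≤s)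
  import Data.Nat.Properties as ℕₚ
  open import Data.Integer as ℤ using (ℤ; +_; -_; _+_; _-_; _*_; ∣_∣)
  import Data.Integer.Properties as ℤₚ
  open import Data.Integer.Tactic.RingSolver using (solve-∀)
  open import Data.Bool using (if_then_else_)
  open import Data.List using (List; []; _∷_; _++_; map; length; filter; concatMap; foldr; upTo)
  import Data.List.Properties as Listₚ
  open import Data.List.Membership.Propositional using (_∈_; find)
  open import Data.List.Membership.Propositional.Properties using (∈-map⁺; ∈-map⁻; ∈-concatMap⁻)
  open import Data.List.Relation.Unary.Any using (here; there)
  open import Data.List.Relation.Unary.All as All using (All; _∷_)
  open import Data.List.Relation.Unary.AllPairs using (AllPairs; _∷_)
  open import Data.List.Relation.Unary.AllPairs.Properties using (applyUpTo⁺₁)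
  open import Data.List.Relation.Binary.Permutation.Propositional as ↭ using (_↭_; prep; swap)
  open import Data.List.Relation.Binary.Permutation.Propositional.Properties using (↭-length; ∈-resp-↭; filter-↭)
  open import Data.Product using (_×_; _,_)
  open import Function using (_∘_)
  open import Relation.Binary.Construct.Closure.ReflexiveTransitive using (Star; ε; _◅_; _◅◅_; gmap)
  open import Relation.Binary.PropositionalEquality

  module _ {A : Set} where

    select-↭ : ∀ (as : List A) {c r} → (c , r) ∈ select as → c ∷ r ↭ as
    select-↭ (a ∷ as) (here refl) = ↭.refl
    select-↭ (a ∷ as) (there m) with ∈-map⁻ _ m
    ... | (c , r) , m′ , refl = ↭.trans (swap c a ↭.refl) (prep a (select-↭ as m′))

    select-length : ∀ (as : List A) {c r} → (c , r) ∈ select as → suc (length r) ≡ length as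
    select-length as m = ↭-length (select-↭ as m)

    select-shorter : ∀ (as : List A) {c r n} → (c , r) ∈ select as → length as ≤ n → length r ≤ n
    select-shorter as m p = ℕₚ.<⇒≤ (ℕₚ.≤-trans (ℕₚ.≤-reflexive (select-length as m)) p)

    select-ind : (P : List A → Set) → P [] →
                 (∀ a as → (∀ {c r} → (c , r) ∈ select as → P r) → P (a ∷ as)) → ∀ xs → P xs
    select-ind P base step xs = go (length xs) xs ℕₚ.≤-refl
      where
        go : ∀ n xs → length xs ≤ n → P xs
        go n       []       _       = base
        go (suc n) (a ∷ as) (s≤s p) = step a as (λ m → go n _ (select-shorter as m p))

    select-∈ : ∀ (as : List A) {c r} → (c , r) ∈ select as → c ∈ as
    select-∈ as m = ∈-resp-↭ (select-↭ as m) (here refl)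

    select-⊆ : ∀ (as : List A) {c r x} → (c , r) ∈ select as → x ∈ r → x ∈ as
    select-⊆ as m = ∈-resp-↭ (select-↭ as m) ∘ there

    -- altSum F [a₀, …, aₙ] = Σᵢ (-1)ⁱ F aᵢ (the list without aᵢ)
    altSum : (A → List A → ℤ) → List A → ℤ
    altSum F []       = + 0
    altSum F (a ∷ as) = F a as - altSum (λ c r → F c (a ∷ r)) as

    altSum-cong : ∀ {F G : A → List A → ℤ} as →
                  (∀ {c r} → (c , r) ∈ select as → F c r ≡ G c r) → altSum F as ≡ altSum G as
    altSum-cong []       h = refl
    altSum-cong (a ∷ as) h = cong₂ _-_ (h (here refl)) (altSum-cong as (h ∘ there ∘ ∈-map⁺ _))

    altSum-vanish : ∀ (F : A → List A → ℤ) as →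
                    (∀ {c r} → (c , r) ∈ select as → F c r ≡ + 0) → altSum F as ≡ + 0
    altSum-vanish F as h = trans (altSum-cong as h) (vanish as)
      where
        vanish : ∀ as → altSum (λ _ _ → + 0) as ≡ + 0
        vanish []       = refl
        vanish (a ∷ as) = cong (λ z → + 0 - z) (vanish as)

    altSum-neg : ∀ (F : A → List A → ℤ) as → altSum (λ c r → - F c r) as ≡ - altSum F as
    altSum-neg F []       = refl
    altSum-neg F (a ∷ as) =
      trans (cong (λ z → - F a as - z) (altSum-neg _ as)) (lemma (F a as) (altSum (λ c r → F c (a ∷ r)) as))
      where
        lemma : ∀ x y → - x - - y ≡ - (x - y)
        lemma = solve-∀

    altSum-sub : ∀ (F G : A → List A → ℤ) as →
                 altSum (λ c r → F c r - G c r) as ≡ altSum F as - altSum G as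
    altSum-sub F G []       = refl
    altSum-sub F G (a ∷ as) =
      trans (cong (λ z → F a as - G a as - z) (altSum-sub _ _ as))
            (lemma (F a as) (G a as) (altSum (λ c r → F c (a ∷ r)) as) (altSum (λ c r → G c (a ∷ r)) as))
      where
        lemma : ∀ x y z w → (x - y) - (z - w) ≡ (x - z) - (y - w)
        lemma = solve-∀

    altSum-scale : ∀ k (F : A → List A → ℤ) as → altSum (λ c r → k * F c r) as ≡ k * altSum F as
    altSum-scale k F []       = sym (ℤₚ.*-zeroʳ k)
    altSum-scale k F (a ∷ as) =
      trans (cong (λ z → k * F a as - z) (altSum-scale k _ as)) (lemma k (F a as) (altSum (λ c r → F c (a ∷ r)) as))
      where
        lemma : ∀ k x y → k * x - k * y ≡ k * (x - y)
        lemma = solve-∀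

    altSum₂ : (A → A → List A → ℤ) → List A → ℤ
    altSum₂ G = altSum (λ c s → altSum (λ d t → G c d t) s)

    altSum₂-swap : ∀ (G : A → A → List A → ℤ) as → altSum₂ (λ c d t → G d c t) as ≡ - altSum₂ G as
    altSum₂-swap G []       = refl
    altSum₂-swap G (h ∷ t) = begin
        altSum (λ d t′ → G d h t′) t - altSum (λ c s → G h c s - altSum (λ d t′ → G d c (h ∷ t′)) s) t
      ≡⟨ cong (λ z → β - z) (altSum-sub _ _ t) ⟩
        β - (α - altSum₂ (λ c d t′ → G d c (h ∷ t′)) t)
      ≡⟨ cong (λ z → β - (α - z)) (altSum₂-swap (λ c d t′ → G c d (h ∷ t′)) t) ⟩
        β - (α - - X)
      ≡⟨ lemma α β X ⟩
        - (α - (β - X))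
      ≡⟨ cong (λ z → - (α - z)) (sym (altSum-sub _ _ t)) ⟩
        - (altSum (λ d t′ → G h d t′) t - altSum (λ c s → G c h s - altSum (λ d t′ → G c d (h ∷ t′)) s) t)
      ∎
      where
        open ≡-Reasoning
        α = altSum (λ d t′ → G h d t′) t
        β = altSum (λ c s → G c h s) t
        X = altSum₂ (λ c d t′ → G c d (h ∷ t′)) t
        lemma : ∀ α β X → β - (α - - X) ≡ - (α - (β - X))
        lemma = solve-∀

    module _ (C : A → A → ℤ) where

      pfaffianᶠ : ℕ → List A → ℤ
      pfaffianᶠ _       []       = + 1
      pfaffianᶠ zero    (_ ∷ _)  = + 0
      pfaffianᶠ (suc n) (a ∷ as) = altSum (λ c r → C a c * pfaffianᶠ n r) as

      -- expansion along the first row; the fuel only ensures termination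
      pfaffian : List A → ℤ
      pfaffian xs = pfaffianᶠ (length xs) xs

      pfaffianᶠ-enough : ∀ xs n → length xs ≤ n → pfaffianᶠ n xs ≡ pfaffian xs
      pfaffianᶠ-enough = select-ind _ (λ _ _ → refl) λ where
        a as ih (suc n) (s≤s p) → altSum-cong as λ {c} m → cong (C a c *_)
          (trans (ih m n (select-shorter as m p)) (sym (ih m (length as) (select-shorter as m ℕₚ.≤-refl))))

      pfaffian-∷ : ∀ a as → pfaffian (a ∷ as) ≡ altSum (λ c r → C a c * pfaffian r) as
      pfaffian-∷ a as = altSum-cong as λ {c} {r} m →
        cong (C a c *_) (pfaffianᶠ-enough r (length as) (select-shorter as m ℕₚ.≤-refl))

    pfaffian-cong : ∀ {C C′ : A → A → ℤ} xs → (∀ {x y} → x ∈ xs → y ∈ xs → C x y ≡ C′ x y) →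
                    pfaffian C xs ≡ pfaffian C′ xs
    pfaffian-cong {C} {C′} = select-ind _ (λ _ → refl) λ a as ih h → begin
        pfaffian C (a ∷ as)                        ≡⟨ pfaffian-∷ C a as ⟩
        altSum (λ c r → C a c * pfaffian C r) as    ≡⟨ altSum-cong as (λ m → cong₂ _*_
                                                         (h (here refl) (there (select-∈ as m)))
                                                         (ih m (λ x∈ y∈ → h (there (select-⊆ as m x∈)) (there (select-⊆ as m y∈))))) ⟩
        altSum (λ c r → C′ a c * pfaffian C′ r) as  ≡⟨ sym (pfaffian-∷ C′ a as) ⟩
        pfaffian C′ (a ∷ as)                       ∎
      where open ≡-Reasoning

    pfaffian-∷∷ : ∀ (C : A → A → ℤ) x y r →
                  pfaffian C (x ∷ y ∷ r) ≡ C x y * pfaffian C r - altSum₂ (λ c d t → C x c * (C y d * pfaffian C t)) r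
    pfaffian-∷∷ C x y r = trans (pfaffian-∷ C x (y ∷ r)) (cong (λ z → C x y * pfaffian C r - z)
      (altSum-cong r λ {c} {s} _ → trans (cong (C x c *_) (pfaffian-∷ C y s)) (sym (altSum-scale (C x c) _ s))))

    altSum-++-vanishing : ∀ (F : A → List A → ℤ) pre rest → (∀ {c r} → c ∈ rest → F c r ≡ + 0) →
                          altSum F (pre ++ rest) ≡ altSum (λ c r → F c (r ++ rest)) pre
    altSum-++-vanishing F []        rest h = altSum-vanish F rest (h ∘ select-∈ rest)
    altSum-++-vanishing F (p ∷ pre) rest h = cong (λ z → F p (pre ++ rest) - z) (altSum-++-vanishing _ pre rest h)

    pfaffian-sparse-row : ∀ (C : A → A → ℤ) u pre rest → (∀ {y} → y ∈ rest → C u y ≡ + 0) →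
                          pfaffian C (u ∷ pre ++ rest) ≡ altSum (λ c r → C u c * pfaffian C (r ++ rest)) pre
    pfaffian-sparse-row C u pre rest h = trans (pfaffian-∷ C u (pre ++ rest))
      (altSum-++-vanishing _ pre rest λ {c} {r} c∈ → trans (cong (_* pfaffian C r) (h c∈)) (ℤₚ.*-zeroˡ (pfaffian C r)))

  module _ {A B : Set} where

    altSum-map : ∀ (g : B → A) (F : A → List A → ℤ) bs →
                 altSum F (map g bs) ≡ altSum (λ c r → F (g c) (map g r)) bs
    altSum-map g F []       = refl
    altSum-map g F (b ∷ bs) = cong (λ z → F (g b) (map g bs) - z) (altSum-map g _ bs)

    pfaffian-map : ∀ (g : B → A) (C : A → A → ℤ) bs →
                   pfaffian C (map g bs) ≡ pfaffian (λ x y → C (g x) (g y)) bs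
    pfaffian-map g C = select-ind _ refl λ b bs ih → begin
        pfaffian C (g b ∷ map g bs)                                 ≡⟨ pfaffian-∷ C (g b) (map g bs) ⟩
        altSum (λ c r → C (g b) c * pfaffian C r) (map g bs)         ≡⟨ altSum-map g _ bs ⟩
        altSum (λ c r → C (g b) (g c) * pfaffian C (map g r)) bs     ≡⟨ altSum-cong bs (λ {c} m → cong (C (g b) (g c) *_) (ih m)) ⟩
        altSum (λ c r → C (g b) (g c) * pfaffian C′ r) bs            ≡⟨ sym (pfaffian-∷ C′ b bs) ⟩
        pfaffian C′ (b ∷ bs)                                        ∎
      where
        open ≡-Reasoning
        C′ = λ x y → C (g x) (g y)

  module _ {A : Set} where

    infix 4 _⇄_

    data _⇄_ : List A → List A → Set where
      ⇄-head : ∀ a b t → a ∷ b ∷ t ⇄ b ∷ a ∷ t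
      ⇄-tail : ∀ h {t t′} → t ⇄ t′ → h ∷ t ⇄ h ∷ t′

    ↭⇒⇄* : ∀ {xs ys} → xs ↭ ys → Star _⇄_ xs ys
    ↭⇒⇄* ↭.refl          = ε
    ↭⇒⇄* (prep x p)      = gmap (x ∷_) (⇄-tail x) (↭⇒⇄* p)
    ↭⇒⇄* (swap x y p)    = ⇄-head x y _ ◅ gmap (λ t → y ∷ x ∷ t) (⇄-tail y ∘ ⇄-tail x) (↭⇒⇄* p)
    ↭⇒⇄* (↭.trans p q)   = ↭⇒⇄* p ◅◅ ↭⇒⇄* q

    altSum-⇄ : ∀ (F : A → List A → ℤ) {t t′} → t ⇄ t′ →
               (∀ {c r r′} → (c , r) ∈ select t → r ⇄ r′ → F c r′ ≡ - F c r) →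
               altSum F t′ ≡ - altSum F t
    altSum-⇄ F (⇄-head a b s) h = begin
        F b (a ∷ s) - (F a (b ∷ s) - altSum (λ c r → F c (b ∷ a ∷ r)) s)
      ≡⟨ cong (λ z → F b (a ∷ s) - (F a (b ∷ s) - z))
           (trans (altSum-cong s (λ {_} {r} m → h (there (∈-map⁺ _ (there (∈-map⁺ _ m)))) (⇄-head a b r)))
                  (altSum-neg _ s)) ⟩
        F b (a ∷ s) - (F a (b ∷ s) - - altSum (λ c r → F c (a ∷ b ∷ r)) s)
      ≡⟨ lemma (F a (b ∷ s)) (F b (a ∷ s)) _ ⟩
        - (F a (b ∷ s) - (F b (a ∷ s) - altSum (λ c r → F c (a ∷ b ∷ r)) s))
      ∎
      where
        open ≡-Reasoning
        lemma : ∀ x y z → y - (x - - z) ≡ - (x - (y - z))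
        lemma = solve-∀
    altSum-⇄ F (⇄-tail g {u} {u′} sw) h = begin
        F g u′ - altSum (λ c r → F c (g ∷ r)) u′
      ≡⟨ cong₂ _-_ (h (here refl) sw) (altSum-⇄ _ sw (λ m s → h (there (∈-map⁺ _ m)) (⇄-tail g s))) ⟩
        - F g u - - altSum (λ c r → F c (g ∷ r)) u
      ≡⟨ lemma (F g u) _ ⟩
        - (F g u - altSum (λ c r → F c (g ∷ r)) u)
      ∎
      where
        open ≡-Reasoning
        lemma : ∀ x y → - x - - y ≡ - (x - y)
        lemma = solve-∀

    module _ {C : A → A → ℤ} (skew : ∀ x y → C x y ≡ - C y x) where

      pfaffian-swap-head : ∀ x y r → pfaffian C (y ∷ x ∷ r) ≡ - pfaffian C (x ∷ y ∷ r)
      pfaffian-swap-head x y r = begin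
          pfaffian C (y ∷ x ∷ r)
        ≡⟨ pfaffian-∷∷ C y x r ⟩
          C y x * pfaffian C r - altSum₂ (λ c d t → C y c * (C x d * pfaffian C t)) r
        ≡⟨ cong₂ (λ u v → u * pfaffian C r - v) (skew y x)
             (trans (altSum-cong r (λ {c} {s} _ → altSum-cong s (λ {d} {t} _ → lemma₁ (C y c) (C x d) (pfaffian C t))))
                    (altSum₂-swap Γ r)) ⟩
          - C x y * pfaffian C r - - altSum₂ Γ r
        ≡⟨ lemma₂ (C x y) (pfaffian C r) _ ⟩
          - (C x y * pfaffian C r - altSum₂ Γ r)
        ≡⟨ cong -_ (sym (pfaffian-∷∷ C x y r)) ⟩
          - pfaffian C (x ∷ y ∷ r)
        ∎
        where
          open ≡-Reasoning
          Γ = λ c d t → C x c * (C y d * pfaffian C t)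
          lemma₁ : ∀ a b p → a * (b * p) ≡ b * (a * p)
          lemma₁ = solve-∀
          lemma₂ : ∀ a p q → - a * p - - q ≡ - (a * p - q)
          lemma₂ = solve-∀

      pfaffian-⇄ : ∀ {xs ys} → xs ⇄ ys → pfaffian C ys ≡ - pfaffian C xs
      pfaffian-⇄ {xs} = select-ind (λ xs → ∀ {ys} → xs ⇄ ys → pfaffian C ys ≡ - pfaffian C xs)
        (λ ()) expand xs
        where
          expand : ∀ a as → (∀ {c r} → (c , r) ∈ select as → ∀ {r′} → r ⇄ r′ → pfaffian C r′ ≡ - pfaffian C r) →
                 ∀ {ys} → a ∷ as ⇄ ys → pfaffian C ys ≡ - pfaffian C (a ∷ as)
          expand a (b ∷ t) ih (⇄-head .a .b .t) = pfaffian-swap-head a b t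
          expand a as ih (⇄-tail .a {t′ = as′} sw) = begin
              pfaffian C (a ∷ as′)                       ≡⟨ pfaffian-∷ C a as′ ⟩
              altSum (λ c r → C a c * pfaffian C r) as′  ≡⟨ altSum-⇄ _ sw (λ {c} {r} m s →
                                                             trans (cong (C a c *_) (ih m s)) (sym (ℤₚ.neg-distribʳ-* (C a c) (pfaffian C r)))) ⟩
              - altSum (λ c r → C a c * pfaffian C r) as ≡⟨ cong -_ (sym (pfaffian-∷ C a as)) ⟩
              - pfaffian C (a ∷ as)                      ∎
            where open ≡-Reasoning

      ∣pfaffian∣-↭ : ∀ {xs ys} → xs ↭ ys → ∣ pfaffian C xs ∣ ≡ ∣ pfaffian C ys ∣
      ∣pfaffian∣-↭ = go ∘ ↭⇒⇄*
        where
          go : ∀ {xs ys} → Star _⇄_ xs ys → ∣ pfaffian C xs ∣ ≡ ∣ pfaffian C ys ∣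
          go ε        = refl
          go {xs} (s ◅ ss) = trans (sym (trans (cong ∣_∣ (pfaffian-⇄ s)) (ℤₚ.∣-i∣≡∣i∣ (pfaffian C xs)))) (go ss)

  sumℤ : List ℤ → ℤ
  sumℤ = foldr _+_ (+ 0)

  sumℤ-++ : ∀ xs ys → sumℤ (xs ++ ys) ≡ sumℤ xs + sumℤ ys
  sumℤ-++ []       ys = sym (ℤₚ.+-identityˡ _)
  sumℤ-++ (x ∷ xs) ys = trans (cong (λ z → x + z) (sumℤ-++ xs ys)) (sym (ℤₚ.+-assoc x _ _))

  module _ {A : Set} where

    sumℤ-cong : ∀ {f g : A → ℤ} xs → (∀ {x} → x ∈ xs → f x ≡ g x) → sumℤ (map f xs) ≡ sumℤ (map g xs)
    sumℤ-cong []       h = refl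
    sumℤ-cong (x ∷ xs) h = cong₂ _+_ (h (here refl)) (sumℤ-cong xs (h ∘ there))

    sumℤ-scale : ∀ k (f : A → ℤ) xs → sumℤ (map (λ x → k * f x) xs) ≡ k * sumℤ (map f xs)
    sumℤ-scale k f []       = sym (ℤₚ.*-zeroʳ k)
    sumℤ-scale k f (x ∷ xs) = trans (cong (λ z → k * f x + z) (sumℤ-scale k f xs)) (sym (ℤₚ.*-distribˡ-+ k (f x) _))

    sumℤ-neg : ∀ (f : A → ℤ) xs → sumℤ (map (λ x → - f x) xs) ≡ - sumℤ (map f xs)
    sumℤ-neg f []       = refl
    sumℤ-neg f (x ∷ xs) = trans (cong (λ z → - f x + z) (sumℤ-neg f xs)) (sym (ℤₚ.neg-distrib-+ (f x) _))

    sumℤ-concatMap : ∀ {B : Set} (f : A → ℤ) (h : B → List A) bs →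
                     sumℤ (map f (concatMap h bs)) ≡ sumℤ (map (λ b → sumℤ (map f (h b))) bs)
    sumℤ-concatMap f h []       = refl
    sumℤ-concatMap f h (b ∷ bs) = begin
        sumℤ (map f (h b ++ concatMap h bs))                  ≡⟨ cong sumℤ (Listₚ.map-++ f (h b) _) ⟩
        sumℤ (map f (h b) ++ map f (concatMap h bs))          ≡⟨ sumℤ-++ (map f (h b)) _ ⟩
        sumℤ (map f (h b)) + sumℤ (map f (concatMap h bs))    ≡⟨ cong (λ z → sumℤ (map f (h b)) + z) (sumℤ-concatMap f h bs) ⟩
        sumℤ (map f (h b)) + sumℤ (map (λ b → sumℤ (map f (h b))) bs) ∎
      where open ≡-Reasoning

    sumℤ-map : ∀ {B : Set} (f : B → ℤ) (g : A → B) xs → sumℤ (map f (map g xs)) ≡ sumℤ (map (f ∘ g) xs)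
    sumℤ-map f g xs = cong sumℤ (sym (Listₚ.map-∘ xs))

    flatten-↭ : ∀ n (xs : List A) {P} → P ∈ pairingsF n xs → flatten P ↭ xs
    flatten-↭ n       []       (here refl) = ↭.refl
    flatten-↭ (suc n) (a ∷ as) m with find (∈-concatMap⁻ _ {xs = select as} m)
    ... | (b , rest) , b∈ , P∈ with ∈-map⁻ _ P∈
    ... | P′ , P′∈ , refl = prep a (↭.trans (prep b (flatten-↭ n rest P′∈)) (select-↭ as b∈))

  select-increasing : ∀ as {b rest} → AllPairs _<_ as → (b , rest) ∈ select as → AllPairs _<_ rest
  select-increasing (x ∷ xs) (_ ∷ s)  (here refl) = s
  select-increasing (x ∷ xs) (x< ∷ s) (there m) with ∈-map⁻ _ m
  ... | (c , r) , m′ , refl = All.tabulate (All.lookup x< ∘ select-⊆ xs m′) ∷ select-increasing xs s m′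

  altSign : ℕ → ℤ
  altSign n = if isEven n then + 1 else - (+ 1)

  altSign-suc : ∀ n → altSign (suc n) ≡ - altSign n
  altSign-suc zero          = refl
  altSign-suc (suc zero)    = refl
  altSign-suc (suc (suc n)) = altSign-suc n

  altSign-+ : ∀ m n → altSign (m ℕ.+ n) ≡ altSign m * altSign n
  altSign-+ zero    n = sym (ℤₚ.*-identityˡ _)
  altSign-+ (suc m) n = begin
      altSign (suc (m ℕ.+ n))     ≡⟨ altSign-suc (m ℕ.+ n) ⟩
      - altSign (m ℕ.+ n)         ≡⟨ cong -_ (altSign-+ m n) ⟩
      - (altSign m * altSign n)   ≡⟨ ℤₚ.neg-distribˡ-* (altSign m) (altSign n) ⟩
      - altSign m * altSign n     ≡⟨ cong (_* altSign n) (sym (altSign-suc m)) ⟩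
      altSign (suc m) * altSign n ∎
    where open ≡-Reasoning

  countBelow : ℕ → List ℕ → ℕ
  countBelow b xs = length (filter (_<? b) xs)

  countBelow-none : ∀ b xs → All (b <_) xs → countBelow b xs ≡ 0
  countBelow-none b []       _        = refl
  countBelow-none b (x ∷ xs) (b<x ∷ ps) =
    trans (cong length (Listₚ.filter-reject (_<? b) (ℕₚ.<-asym b<x))) (countBelow-none b xs ps)

  countBelow-↭ : ∀ b {xs ys} → xs ↭ ys → countBelow b xs ≡ countBelow b ys
  countBelow-↭ b p = ↭-length (filter-↭ (_<? b) p)

  -- On an increasing list the entries below the i-th one are the i entries before it,
  -- so countBelow recovers the sign (-1)ⁱ of altSum.
  sumℤ-select : ∀ as → AllPairs _<_ as → ∀ (F : ℕ → List ℕ → ℤ) →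
                sumℤ (map (λ (c , r) → altSign (countBelow c r) * F c r) (select as)) ≡ altSum F as
  sumℤ-select []       _          F = refl
  sumℤ-select (x ∷ xs) (x< ∷ inc) F = cong₂ _+_
    (trans (cong (λ k → altSign k * F x xs) (countBelow-none x xs x<)) (ℤₚ.*-identityˡ _))
    (begin
      sumℤ (map (λ (c , r) → altSign (countBelow c r) * F c r) (map (λ (c , r) → c , x ∷ r) (select xs)))
    ≡⟨ sumℤ-map _ _ (select xs) ⟩
      sumℤ (map (λ (c , r) → altSign (countBelow c (x ∷ r)) * F c (x ∷ r)) (select xs))
    ≡⟨ sumℤ-cong (select xs) (λ {(c , r)} m → shift c r (All.lookup x< (select-∈ xs m))) ⟩
      sumℤ (map (λ (c , r) → - (altSign (countBelow c r) * F c (x ∷ r))) (select xs))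
    ≡⟨ sumℤ-neg _ (select xs) ⟩
      - sumℤ (map (λ (c , r) → altSign (countBelow c r) * F c (x ∷ r)) (select xs))
    ≡⟨ cong -_ (sumℤ-select xs inc (λ c r → F c (x ∷ r))) ⟩
      - altSum (λ c r → F c (x ∷ r)) xs
    ∎)
    where
      open ≡-Reasoning
      shift : ∀ c r → x < c → altSign (countBelow c (x ∷ r)) * F c (x ∷ r) ≡ - (altSign (countBelow c r) * F c (x ∷ r))
      shift c r x<c = begin
        altSign (countBelow c (x ∷ r)) * F c (x ∷ r)   ≡⟨ cong (λ l → altSign (length l) * F c (x ∷ r)) (Listₚ.filter-accept (_<? c) x<c) ⟩
        altSign (suc (countBelow c r)) * F c (x ∷ r)   ≡⟨ cong (_* F c (x ∷ r)) (altSign-suc (countBelow c r)) ⟩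
        - altSign (countBelow c r) * F c (x ∷ r)       ≡⟨ sym (ℤₚ.neg-distribˡ-* (altSign (countBelow c r)) (F c (x ∷ r))) ⟩
        - (altSign (countBelow c r) * F c (x ∷ r))     ∎

  module _ (C : ℕ → ℕ → ℤ) where

    weight : List (ℕ × ℕ) → ℤ
    weight P = foldr _*_ (+ 1) (map (λ (i , j) → C i j) P)

    term : List (ℕ × ℕ) → ℤ
    term P = sgn (flatten P) * weight P

    term-∷ : ∀ a b P rest → All (a <_) (b ∷ rest) → flatten P ↭ rest →
             term ((a , b) ∷ P) ≡ altSign (countBelow b rest) * (C a b * term P)
    term-∷ a b P rest a< P↭ = begin
        altSign (countBelow a (b ∷ flatten P) ℕ.+ (countBelow b (flatten P) ℕ.+ inv)) * (C a b * weight P)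
      ≡⟨ cong (λ k → altSign (k ℕ.+ (countBelow b (flatten P) ℕ.+ inv)) * (C a b * weight P))
           (countBelow-none a (b ∷ flatten P) (All.tabulate (All.lookup a< ∘ ∈-resp-↭ (prep b P↭)))) ⟩
        altSign (countBelow b (flatten P) ℕ.+ inv) * (C a b * weight P)
      ≡⟨ cong (λ k → altSign (k ℕ.+ inv) * (C a b * weight P)) (countBelow-↭ b P↭) ⟩
        altSign (countBelow b rest ℕ.+ inv) * (C a b * weight P)
      ≡⟨ cong (_* (C a b * weight P)) (altSign-+ (countBelow b rest) inv) ⟩
        (altSign (countBelow b rest) * altSign inv) * (C a b * weight P)
      ≡⟨ lemma (altSign (countBelow b rest)) (altSign inv) (C a b) (weight P) ⟩
        altSign (countBelow b rest) * (C a b * (altSign inv * weight P))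
      ∎
      where
        open ≡-Reasoning
        inv = inversions (flatten P)
        lemma : ∀ s t c p → (s * t) * (c * p) ≡ s * (c * (t * p))
        lemma = solve-∀

    pairingSum : ℕ → List ℕ → ℤ
    pairingSum n xs = sumℤ (map term (pairingsF n xs))

    pairingSum-pfaffian : ∀ n xs → AllPairs _<_ xs → length xs ≤ n → pairingSum n xs ≡ pfaffian C xs
    pairingSum-pfaffian n       []       _          _       = refl
    pairingSum-pfaffian (suc n) (a ∷ as) (a< ∷ inc) (s≤s p) = begin
        sumℤ (map term (concatMap (λ (b , r) → map ((a , b) ∷_) (pairingsF n r)) (select as)))
      ≡⟨ sumℤ-concatMap term _ (select as) ⟩
        sumℤ (map (λ (b , r) → sumℤ (map term (map ((a , b) ∷_) (pairingsF n r)))) (select as))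
      ≡⟨ sumℤ-cong (select as) (λ {(b , r)} m → expand b r m) ⟩
        sumℤ (map (λ (b , r) → altSign (countBelow b r) * (C a b * pfaffian C r)) (select as))
      ≡⟨ sumℤ-select as inc (λ b r → C a b * pfaffian C r) ⟩
        altSum (λ b r → C a b * pfaffian C r) as
      ≡⟨ sym (pfaffian-∷ C a as) ⟩
        pfaffian C (a ∷ as)
      ∎
      where
        open ≡-Reasoning
        expand : ∀ b r → (b , r) ∈ select as →
                 sumℤ (map term (map ((a , b) ∷_) (pairingsF n r))) ≡ altSign (countBelow b r) * (C a b * pfaffian C r)
        expand b r m = begin
            sumℤ (map term (map ((a , b) ∷_) (pairingsF n r)))
          ≡⟨ sumℤ-map term _ (pairingsF n r) ⟩
            sumℤ (map (λ P → term ((a , b) ∷ P)) (pairingsF n r))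
          ≡⟨ sumℤ-cong (pairingsF n r) (λ {P} P∈ →
               term-∷ a b P r (All.tabulate (All.lookup a< ∘ ∈-resp-↭ (select-↭ as m))) (flatten-↭ n r P∈)) ⟩
            sumℤ (map (λ P → altSign (countBelow b r) * (C a b * term P)) (pairingsF n r))
          ≡⟨ sumℤ-scale (altSign (countBelow b r)) _ (pairingsF n r) ⟩
            altSign (countBelow b r) * sumℤ (map (λ P → C a b * term P) (pairingsF n r))
          ≡⟨ cong (altSign (countBelow b r) *_) (sumℤ-scale (C a b) term (pairingsF n r)) ⟩
            altSign (countBelow b r) * (C a b * pairingSum n r)
          ≡⟨ cong (λ z → altSign (countBelow b r) * (C a b * z))
               (pairingSum-pfaffian n r (select-increasing as inc m) (select-shorter as m p)) ⟩
            altSign (countBelow b r) * (C a b * pfaffian C r)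
          ∎

  pff≡pfaffian : ∀ n (C : ℕ → ℕ → ℤ) → pff n C ≡ pfaffian C (upTo n)
  pff≡pfaffian n C = trans (cong (λ m → pairingSum C m (upTo n)) (Listₚ.length-upTo n))
    (pairingSum-pfaffian C n (upTo n) (applyUpTo⁺₁ _ n (λ i<j _ → i<j)) (ℕₚ.≤-reflexive (Listₚ.length-upTo n)))

module FactorCounts where

  open import Data.Nat as ℕ using (ℕ; suc; _+_; _∸_; _≤_; z≤n; s≤s)
  import Data.Nat.Properties as ℕₚ
  open import Algebra.Properties.CommutativeSemigroup ℕₚ.+-commutativeSemigroup using (interchange)
  open import Data.Bool using (if_then_else_)
  open import Data.Empty using (⊥-elim)
  open import Data.List using (List; []; _∷_; _++_; map; length; filter)
  import Data.List.Properties as Listₚ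
  open import Data.List.Membership.Propositional using (_∈_; _∉_)
  open import Data.List.Membership.Propositional.Properties using (∈-++⁻; ∈-map⁻)
  open import Data.List.Relation.Unary.Any using (here; there)
  open import Data.List.Relation.Unary.All as All using (All; _∷_)
  open import Data.List.Relation.Binary.Permutation.Propositional as ↭ using (_↭_; prep; swap)
  open import Data.List.Relation.Binary.Permutation.Propositional.Properties using (↭-length; filter-↭)
  open import Data.Product using (_×_; _,_; proj₁; proj₂)
  open import Data.Sum using (_⊎_; inj₁; inj₂)
  open import Function using (_∘_; id; const)
  open import Relation.Nullary using (¬_; yes; no; does)
  open import Relation.Nullary.Decidable using (dec-true; dec-false)
  open import Relation.Unary using (Decidable)
  open import Relation.Binary.PropositionalEquality

  private variable A B : Set

  count : {P : A → Set} → Decidable P → List A → ℕ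
  count P? xs = length (filter P? xs)

  count-map : ∀ {P : B → Set} (P? : Decidable P) (g : A → B) xs → count P? (map g xs) ≡ count (P? ∘ g) xs
  count-map P? g []       = refl
  count-map P? g (x ∷ xs) with P? (g x)
  ... | yes _ = cong suc (count-map P? g xs)
  ... | no  _ = count-map P? g xs

  count-cong : ∀ {P Q : A → Set} (P? : Decidable P) (Q? : Decidable Q) xs →
               (∀ {x} → x ∈ xs → P x → Q x) → (∀ {x} → x ∈ xs → Q x → P x) → count P? xs ≡ count Q? xs
  count-cong P? Q? []       f g = refl
  count-cong P? Q? (x ∷ xs) f g with P? x | Q? x
  ... | yes _ | yes _ = cong suc (count-cong P? Q? xs (f ∘ there) (g ∘ there))
  ... | no  _ | no  _ = count-cong P? Q? xs (f ∘ there) (g ∘ there)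
  ... | yes p | no ¬q = ⊥-elim (¬q (f (here refl) p))
  ... | no ¬p | yes q = ⊥-elim (¬p (g (here refl) q))

  count-++ : ∀ {P : A → Set} (P? : Decidable P) xs ys → count P? (xs ++ ys) ≡ count P? xs + count P? ys
  count-++ P? xs ys = trans (cong length (Listₚ.filter-++ P? xs ys)) (Listₚ.length-++ (filter P? xs))

  count-none : ∀ {P : A → Set} (P? : Decidable P) xs → (∀ {x} → x ∈ xs → ¬ P x) → count P? xs ≡ 0
  count-none P? []       h = refl
  count-none P? (x ∷ xs) h = trans (cong length (Listₚ.filter-reject P? (h (here refl)))) (count-none P? xs (h ∘ there))

  count-pos : ∀ {P : A → Set} (P? : Decidable P) {x} xs → x ∈ xs → P x → 1 ≤ count P? xs
  count-pos P? (y ∷ ys) (here refl) px = subst (1 ≤_) (sym (cong length (Listₚ.filter-accept P? px))) (s≤s z≤n)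
  count-pos P? (y ∷ ys) (there x∈) px with P? y
  ... | yes _ = ℕₚ.m≤n⇒m≤1+n (count-pos P? ys x∈ px)
  ... | no  _ = count-pos P? ys x∈ px

  count-↭ : ∀ {P : A → Set} (P? : Decidable P) {xs ys} → xs ↭ ys → count P? xs ≡ count P? ys
  count-↭ P? p = ↭-length (filter-↭ P? p)

  sublists-⊆ : ∀ (E : List A) {M x} → M ∈ sublists E → x ∈ M → x ∈ E
  sublists-⊆ []      (here refl) ()
  sublists-⊆ (e ∷ E) m x∈ with ∈-++⁻ (map (e ∷_) (sublists E)) m
  ... | inj₂ m′ = there (sublists-⊆ E m′ x∈)
  ... | inj₁ m′ with ∈-map⁻ (e ∷_) m′
  ... | M′ , m″ , refl with x∈
  ...   | here x≡e = here x≡e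
  ...   | there x∈′ = there (sublists-⊆ E m″ x∈′)

  count-sublists-∷ : ∀ {P : List A → Set} (P? : Decidable P) e E →
                     count P? (sublists (e ∷ E)) ≡ count (P? ∘ (e ∷_)) (sublists E) + count P? (sublists E)
  count-sublists-∷ P? e E = begin
      length (filter P? (map (e ∷_) (sublists E) ++ sublists E))
    ≡⟨ count-++ P? (map (e ∷_) (sublists E)) (sublists E) ⟩
      length (filter P? (map (e ∷_) (sublists E))) + count P? (sublists E)
    ≡⟨ cong (_+ count P? (sublists E)) (count-map P? (e ∷_) (sublists E)) ⟩
      count (P? ∘ (e ∷_)) (sublists E) + count P? (sublists E)
    ∎
    where open ≡-Reasoning

  count-sublists-↭ : ∀ {P : List A → Set} (P? : Decidable P) → (∀ {M M′} → M ↭ M′ → P M → P M′) →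
                     ∀ {E E′} → E ↭ E′ → count P? (sublists E) ≡ count P? (sublists E′)
  count-sublists-↭ P? resp ↭.refl          = refl
  count-sublists-↭ P? resp (↭.trans p q)   = trans (count-sublists-↭ P? resp p) (count-sublists-↭ P? resp q)
  count-sublists-↭ P? resp {e ∷ E} {e ∷ E′} (prep e p) = begin
      count P? (sublists (e ∷ E))
    ≡⟨ count-sublists-∷ P? e E ⟩
      count (P? ∘ (e ∷_)) (sublists E) + count P? (sublists E)
    ≡⟨ cong₂ _+_ (count-sublists-↭ (P? ∘ (e ∷_)) (resp ∘ prep e) p) (count-sublists-↭ P? resp p) ⟩
      count (P? ∘ (e ∷_)) (sublists E′) + count P? (sublists E′)
    ≡⟨ sym (count-sublists-∷ P? e E′) ⟩
      count P? (sublists (e ∷ E′))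
    ∎
    where open ≡-Reasoning
  count-sublists-↭ P? resp {e ∷ e′ ∷ E} {e′ ∷ e ∷ E′} (swap e e′ p) = begin
      count P? (sublists (e ∷ e′ ∷ E))
    ≡⟨ split e e′ E ⟩
      (# (P? ∘ (e ∷_) ∘ (e′ ∷_)) E + # (P? ∘ (e ∷_)) E) + (# (P? ∘ (e′ ∷_)) E + # P? E)
    ≡⟨ cong₂ (λ x y → (x + # (P? ∘ (e ∷_)) E) + y) (count-sublists-↭ _ (resp ∘ prep e ∘ prep e′) p)
                                                 (cong₂ _+_ (count-sublists-↭ _ (resp ∘ prep e′) p) (count-sublists-↭ P? resp p)) ⟩
      (# (P? ∘ (e ∷_) ∘ (e′ ∷_)) E′ + # (P? ∘ (e ∷_)) E) + (# (P? ∘ (e′ ∷_)) E′ + # P? E′)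
    ≡⟨ cong₂ (λ x y → (x + y) + (# (P? ∘ (e′ ∷_)) E′ + # P? E′))
         (count-cong _ _ (sublists E′) (λ _ → resp (swap e e′ ↭.refl)) (λ _ → resp (swap e′ e ↭.refl)))
         (count-sublists-↭ _ (resp ∘ prep e) p) ⟩
      (# (P? ∘ (e′ ∷_) ∘ (e ∷_)) E′ + # (P? ∘ (e ∷_)) E′) + (# (P? ∘ (e′ ∷_)) E′ + # P? E′)
    ≡⟨ interchange (# (P? ∘ (e′ ∷_) ∘ (e ∷_)) E′) (# (P? ∘ (e ∷_)) E′) (# (P? ∘ (e′ ∷_)) E′) (# P? E′) ⟩
      (# (P? ∘ (e′ ∷_) ∘ (e ∷_)) E′ + # (P? ∘ (e′ ∷_)) E′) + (# (P? ∘ (e ∷_)) E′ + # P? E′)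
    ≡⟨ sym (split e′ e E′) ⟩
      count P? (sublists (e′ ∷ e ∷ E′))
    ∎
    where
      open ≡-Reasoning
      # : ∀ {Q : List A → Set} → Decidable Q → List A → ℕ
      # Q? E = count Q? (sublists E)
      split : ∀ x y E → # P? (x ∷ y ∷ E) ≡ (# (P? ∘ (x ∷_) ∘ (y ∷_)) E + # (P? ∘ (x ∷_)) E) + (# (P? ∘ (y ∷_)) E + # P? E)
      split x y E = trans (count-sublists-∷ P? x (y ∷ E))
        (cong₂ _+_ (count-sublists-∷ (P? ∘ (x ∷_)) y E) (count-sublists-∷ P? y E))

  Incident : Point → Seg → Set
  Incident v e = proj₁ e ≡ v ⊎ proj₂ e ≡ v

  incidence : Point → Seg → ℕ
  incidence v e = if does (incident v e) then 1 else 0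

  incidence-yes : ∀ {v e} → Incident v e → incidence v e ≡ 1
  incidence-yes {v} {e} i = cong (if_then 1 else 0) (dec-true (incident v e) i)

  incidence-no : ∀ {v e} → ¬ Incident v e → incidence v e ≡ 0
  incidence-no {v} {e} ¬i = cong (if_then 1 else 0) (dec-false (incident v e) ¬i)

  incidence-left : ∀ x y → incidence x (x , y) ≡ 1
  incidence-left x y = incidence-yes {x} {x , y} (inj₁ refl)

  incidence-right : ∀ x y → incidence y (x , y) ≡ 1
  incidence-right x y = incidence-yes {y} {x , y} (inj₂ refl)

  incidence-other : ∀ {v x y} → v ≢ x → v ≢ y → incidence v (x , y) ≡ 0
  incidence-other v≢x v≢y = incidence-no λ { (inj₁ x≡v) → v≢x (sym x≡v) ; (inj₂ y≡v) → v≢y (sym y≡v) }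

  degreeIn-∷ : ∀ e M v → degreeIn (e ∷ M) v ≡ incidence v e + degreeIn M v
  degreeIn-∷ e M v with incident v e
  ... | yes i = trans (cong length (Listₚ.filter-accept (incident v) i)) (cong (_+ degreeIn M v) (sym (incidence-yes i)))
  ... | no ¬i = trans (cong length (Listₚ.filter-reject (incident v) ¬i)) (cong (_+ degreeIn M v) (sym (incidence-no ¬i)))

  degreeIn-isolated : ∀ (E : List Seg) {M} v → M ∈ sublists E → (∀ {e} → e ∈ E → ¬ Incident v e) → degreeIn M v ≡ 0
  degreeIn-isolated E v m isolated = count-none (incident v) _ (isolated ∘ sublists-⊆ E m)

  HasDegrees : List Point → (Point → ℕ) → List Seg → Set
  HasDegrees V f M = All (λ v → degreeIn M v ≡ f v) V

  hasDegrees? : ∀ V f → Decidable (HasDegrees V f)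
  hasDegrees? V f M = All.all? (λ v → degreeIn M v ℕ.≟ f v) V

  HasDegrees-cong : ∀ {V V′ f g M M′} → (∀ {v} → v ∈ V′ → v ∈ V) →
                    (∀ {v} → v ∈ V′ → degreeIn M v ≡ degreeIn M′ v) → (∀ {v} → v ∈ V′ → f v ≡ g v) →
                    HasDegrees V f M → HasDegrees V′ g M′
  HasDegrees-cong V′⊆V deg f≗g hd = All.tabulate λ v∈ →
    trans (sym (deg v∈)) (trans (All.lookup hd (V′⊆V v∈)) (f≗g v∈))

  factorCount : List Seg → List Point → (Point → ℕ) → ℕ
  factorCount E V f = count (hasDegrees? V f) (sublists E)

  factorCount-cong : ∀ E {V V′ f g} → (∀ {v} → v ∈ V → v ∈ V′) → (∀ {v} → v ∈ V′ → v ∈ V) →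
                     (∀ {v} → v ∈ V → f v ≡ g v) → factorCount E V f ≡ factorCount E V′ g
  factorCount-cong E V⊆V′ V′⊆V f≗g = count-cong _ _ (sublists E)
    (λ {M} _ → HasDegrees-cong {M = M} {M′ = M} V′⊆V (λ _ → refl) (f≗g ∘ V′⊆V))
    (λ {M} _ → HasDegrees-cong {M = M} {M′ = M} V⊆V′ (λ _ → refl) (sym ∘ f≗g))

  factorCount-cong-degrees : ∀ E V {f g} → (∀ {v} → v ∈ V → f v ≡ g v) → factorCount E V f ≡ factorCount E V g
  factorCount-cong-degrees E V = factorCount-cong E id id

  factorCount-↭ : ∀ {E E′} → E ↭ E′ → ∀ V f → factorCount E V f ≡ factorCount E′ V f
  factorCount-↭ p V f = count-sublists-↭ (hasDegrees? V f)
    (λ {M} {M′} M↭M′ → HasDegrees-cong {M = M} {M′ = M′} id (λ {v} _ → count-↭ (incident v) M↭M′) (λ _ → refl)) p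

  _⊖_ : (Point → ℕ) → Seg → Point → ℕ
  (f ⊖ e) v = f v ∸ incidence v e

  -- the f-factors containing e correspond to the (f ⊖ e)-factors of E
  factorCount-∷ : ∀ e E V f → (∀ {v} → v ∈ V → Incident v e → 1 ≤ f v) →
                  factorCount (e ∷ E) V f ≡ factorCount E V (f ⊖ e) + factorCount E V f
  factorCount-∷ e E V f positive = trans (count-sublists-∷ (hasDegrees? V f) e E) (cong (_+ factorCount E V f)
    (count-cong _ _ (sublists E)
      (λ _ hd → All.tabulate λ v∈ → contract v∈ (All.lookup hd v∈))
      (λ _ hd → All.tabulate λ v∈ → expand v∈ (All.lookup hd v∈))))
    where
      contract : ∀ {M v} → v ∈ V → degreeIn (e ∷ M) v ≡ f v → degreeIn M v ≡ (f ⊖ e) v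
      contract {M} {v} _ d = trans (sym (ℕₚ.m+n∸m≡n (incidence v e) (degreeIn M v)))
                                   (cong (_∸ incidence v e) (trans (sym (degreeIn-∷ e M v)) d))
      expand : ∀ {M v} → v ∈ V → degreeIn M v ≡ (f ⊖ e) v → degreeIn (e ∷ M) v ≡ f v
      expand {M} {v} v∈ d = trans (degreeIn-∷ e M v) (trans (cong (incidence v e +_) d) (ℕₚ.m+[n∸m]≡n bounded))
        where
          bounded : incidence v e ≤ f v
          bounded with incident v e
          ... | yes i = subst (_≤ f v) (sym (incidence-yes i)) (positive v∈ i)
          ... | no ¬i = subst (_≤ f v) (sym (incidence-no ¬i)) z≤n

  factorCount-∷-saturated : ∀ e E V f {v} → v ∈ V → Incident v e → f v ≡ 0 →
                            factorCount (e ∷ E) V f ≡ factorCount E V f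
  factorCount-∷-saturated e E V f {v} v∈ i fv≡0 = trans (count-sublists-∷ (hasDegrees? V f) e E)
    (cong (_+ factorCount E V f) (count-none _ (sublists E) λ {M} _ hd →
      ℕₚ.1+n≢0 (begin
        suc (degreeIn M v)                  ≡⟨ cong (_+ degreeIn M v) (sym (incidence-yes i)) ⟩
        incidence v e + degreeIn M v        ≡⟨ sym (degreeIn-∷ e M v) ⟩
        degreeIn (e ∷ M) v                  ≡⟨ All.lookup hd v∈ ⟩
        f v                                 ≡⟨ fv≡0 ⟩
        0                                   ∎)))
    where open ≡-Reasoning

  factorCount-isolated : ∀ E V f {v} → (∀ {e} → e ∈ E → ¬ Incident v e) → f v ≡ 0 →
                         factorCount E (v ∷ V) f ≡ factorCount E V f
  factorCount-isolated E V f {v} isolated fv≡0 = count-cong _ _ (sublists E)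
    (λ {M} _ → HasDegrees-cong {M = M} {M′ = M} there (λ _ → refl) (λ _ → refl))
    (λ m hd → trans (degreeIn-isolated E v m isolated) (sym fv≡0) ∷ hd)

  factorCount-unsatisfiable : ∀ E V f {v} → v ∈ V → (∀ {e} → e ∈ E → ¬ Incident v e) → f v ≢ 0 → factorCount E V f ≡ 0
  factorCount-unsatisfiable E V f {v} v∈ isolated fv≢0 = count-none _ (sublists E)
    (λ m hd → fv≢0 (trans (sym (All.lookup hd v∈)) (degreeIn-isolated E v m isolated)))

  -- the degrees of a perfect matching of the graph with a and b deleted
  allBut : Point → Point → Point → ℕ
  allBut a b v = if does (v ≟P a) then 0 else if does (v ≟P b) then 0 else 1

  allBut-left : ∀ a b → allBut a b a ≡ 0
  allBut-left a b = cong (λ t → if t then 0 else if does (a ≟P b) then 0 else 1) (dec-true (a ≟P a) refl)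

  allBut-right : ∀ a b → allBut a b b ≡ 0
  allBut-right a b with b ≟P a
  ... | yes _ = refl
  ... | no  _ = cong (if_then 0 else 1) (dec-true (b ≟P b) refl)

  allBut-other : ∀ {a b v} → v ≢ a → v ≢ b → allBut a b v ≡ 1
  allBut-other {a} {b} {v} v≢a v≢b = trans (cong (λ t → if t then 0 else if does (v ≟P b) then 0 else 1) (dec-false (v ≟P a) v≢a))
                                           (cong (if_then 0 else 1) (dec-false (v ≟P b) v≢b))

  -- A square glued along the segment from a to b: fresh vertices u, w and new edges uw, au, bw.
  record Attachment (u w a b : Point) (V : List Point) (E : List Seg) : Set where
    field
      u∉V : u ∉ V
      w∉V : w ∉ V
      u≢w : u ≢ w
      a∈V : a ∈ V
      b∈V : b ∈ V
      a≢b : a ≢ b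
      E⊆V² : ∀ {e} → e ∈ E → proj₁ e ∈ V × proj₂ e ∈ V

  module _ {u w a b V E} (att : Attachment u w a b V E) where
    open Attachment att

    private
      V⁺ : List Point
      V⁺ = u ∷ w ∷ V

      uw au bw : Seg
      uw = (u , w)
      au = (a , u)
      bw = (b , w)

      ≢u : ∀ {v} → v ∈ V → v ≢ u
      ≢u v∈ refl = u∉V v∈

      ≢w : ∀ {v} → v ∈ V → v ≢ w
      ≢w v∈ refl = w∉V v∈

      isolated : ∀ {x} → x ∉ V → ∀ {e} → e ∈ E → ¬ Incident x e
      isolated x∉V e∈ (inj₁ refl) = x∉V (proj₁ (E⊆V² e∈))
      isolated x∉V e∈ (inj₂ refl) = x∉V (proj₂ (E⊆V² e∈))

      drop-uw : ∀ f → f u ≡ 0 → f w ≡ 0 → factorCount E V⁺ f ≡ factorCount E V f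
      drop-uw f fu≡0 fw≡0 = trans (factorCount-isolated E (w ∷ V) f (isolated u∉V) fu≡0)
                                  (factorCount-isolated E V f (isolated w∉V) fw≡0)

      stuck-u : ∀ f → f u ≡ 1 → factorCount E V⁺ f ≡ 0
      stuck-u f fu≡1 = factorCount-unsatisfiable E V⁺ f (here refl) (isolated u∉V) (λ fu≡0 → ℕₚ.1+n≢0 (trans (sym fu≡1) fu≡0))

      stuck-w : ∀ f → f w ≡ 1 → factorCount E V⁺ f ≡ 0
      stuck-w f fw≡1 = factorCount-unsatisfiable E V⁺ f (there (here refl)) (isolated w∉V) (λ fw≡0 → ℕₚ.1+n≢0 (trans (sym fw≡1) fw≡0))

      agrees-allBut : ∀ (g : Point → ℕ) → g a ≡ 0 → g b ≡ 0 → (∀ {v} → v ∈ V → v ≢ a → v ≢ b → g v ≡ 1) →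
                      ∀ {v} → v ∈ V → g v ≡ allBut a b v
      agrees-allBut g ga≡0 gb≡0 g≡1 {v} v∈ with v ≟P a | v ≟P b
      ... | yes refl | _        = ga≡0
      ... | no  _    | yes refl = gb≡0
      ... | no  v≢a  | no  v≢b  = g≡1 v∈ v≢a v≢b

      containing-uw : factorCount (au ∷ bw ∷ E) V⁺ (const 1 ⊖ uw) ≡ factorCount E V (const 1)
      containing-uw = begin
          factorCount (au ∷ bw ∷ E) V⁺ f ≡⟨ factorCount-∷-saturated au (bw ∷ E) V⁺ f (here refl) (inj₂ refl) fu≡0 ⟩
          factorCount (bw ∷ E) V⁺ f      ≡⟨ factorCount-∷-saturated bw E V⁺ f (there (here refl)) (inj₂ refl) fw≡0 ⟩
          factorCount E V⁺ f             ≡⟨ drop-uw f fu≡0 fw≡0 ⟩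
          factorCount E V f              ≡⟨ factorCount-cong-degrees E V (λ v∈ → cong (1 ∸_) (incidence-other (≢u v∈) (≢w v∈))) ⟩
          factorCount E V (const 1)      ∎
        where
          open ≡-Reasoning
          f = const 1 ⊖ uw
          fu≡0 = cong (1 ∸_) (incidence-left u w)
          fw≡0 = cong (1 ∸_) (incidence-right u w)

      containing-au : factorCount (bw ∷ E) V⁺ (const 1 ⊖ au) ≡ factorCount E V (allBut a b)
      containing-au = begin
          factorCount (bw ∷ E) V⁺ f
        ≡⟨ factorCount-∷ bw E V⁺ f (λ _ → λ { (inj₁ refl) → ℕₚ.≤-reflexive (sym fb≡1) ; (inj₂ refl) → ℕₚ.≤-reflexive (sym fw≡1) }) ⟩
          factorCount E V⁺ g + factorCount E V⁺ f
        ≡⟨ cong₂ _+_ (drop-uw g gu≡0 gw≡0) (stuck-w f fw≡1) ⟩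
          factorCount E V g + 0
        ≡⟨ ℕₚ.+-identityʳ _ ⟩
          factorCount E V g
        ≡⟨ factorCount-cong-degrees E V (agrees-allBut g ga≡0 gb≡0 g≡1) ⟩
          factorCount E V (allBut a b)
        ∎
        where
          open ≡-Reasoning
          f = const 1 ⊖ au
          g = f ⊖ bw
          fb≡1 = cong (1 ∸_) (incidence-other (λ b≡a → a≢b (sym b≡a)) (≢u b∈V))
          fw≡1 = cong (1 ∸_) (incidence-other (λ w≡a → ≢w a∈V (sym w≡a)) (λ w≡u → u≢w (sym w≡u)))
          gu≡0 = trans (cong (λ t → (1 ∸ t) ∸ incidence u bw) (incidence-right a u)) (ℕₚ.0∸n≡0 (incidence u bw))
          gw≡0 = cong₂ _∸_ fw≡1 (incidence-right b w)
          ga≡0 = trans (cong (λ t → (1 ∸ t) ∸ incidence a bw) (incidence-left a u)) (ℕₚ.0∸n≡0 (incidence a bw))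
          gb≡0 = cong₂ _∸_ fb≡1 (incidence-left b w)
          g≡1 : ∀ {v} → v ∈ V → v ≢ a → v ≢ b → g v ≡ 1
          g≡1 v∈ v≢a v≢b = cong₂ (λ s t → (1 ∸ s) ∸ t) (incidence-other v≢a (≢u v∈)) (incidence-other v≢b (≢w v∈))

      avoiding-au : factorCount (bw ∷ E) V⁺ (const 1) ≡ 0
      avoiding-au = begin
          factorCount (bw ∷ E) V⁺ (const 1)
        ≡⟨ factorCount-∷ bw E V⁺ (const 1) (λ _ _ → s≤s z≤n) ⟩
          factorCount E V⁺ (const 1 ⊖ bw) + factorCount E V⁺ (const 1)
        ≡⟨ cong₂ _+_ (stuck-u _ (cong (1 ∸_) (incidence-other (λ u≡b → ≢u b∈V (sym u≡b)) u≢w))) (stuck-u (const 1) refl) ⟩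
          0
        ∎
        where open ≡-Reasoning

      avoiding-uw : factorCount (au ∷ bw ∷ E) V⁺ (const 1) ≡ factorCount E V (allBut a b)
      avoiding-uw = begin
          factorCount (au ∷ bw ∷ E) V⁺ (const 1)
        ≡⟨ factorCount-∷ au (bw ∷ E) V⁺ (const 1) (λ _ _ → s≤s z≤n) ⟩
          factorCount (bw ∷ E) V⁺ (const 1 ⊖ au) + factorCount (bw ∷ E) V⁺ (const 1)
        ≡⟨ cong₂ _+_ containing-au avoiding-au ⟩
          factorCount E V (allBut a b) + 0
        ≡⟨ ℕₚ.+-identityʳ _ ⟩
          factorCount E V (allBut a b)
        ∎
        where open ≡-Reasoning

    factorCount-attach : factorCount ((u , w) ∷ (a , u) ∷ (b , w) ∷ E) (u ∷ w ∷ V) (const 1)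
                         ≡ factorCount E V (const 1) + factorCount E V (allBut a b)
    factorCount-attach = trans (factorCount-∷ uw (au ∷ bw ∷ E) V⁺ (const 1) (λ _ _ → s≤s z≤n)) (cong₂ _+_ containing-uw avoiding-uw)

    factorCount-attach-without-uw : factorCount ((u , w) ∷ (a , u) ∷ (b , w) ∷ E) (u ∷ w ∷ V) (allBut u w) ≡ factorCount E V (const 1)
    factorCount-attach-without-uw = begin
        factorCount (uw ∷ au ∷ bw ∷ E) V⁺ f ≡⟨ factorCount-∷-saturated uw (au ∷ bw ∷ E) V⁺ f (here refl) (inj₁ refl) fu≡0 ⟩
        factorCount (au ∷ bw ∷ E) V⁺ f      ≡⟨ factorCount-∷-saturated au (bw ∷ E) V⁺ f (here refl) (inj₂ refl) fu≡0 ⟩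
        factorCount (bw ∷ E) V⁺ f           ≡⟨ factorCount-∷-saturated bw E V⁺ f (there (here refl)) (inj₂ refl) fw≡0 ⟩
        factorCount E V⁺ f                  ≡⟨ drop-uw f fu≡0 fw≡0 ⟩
        factorCount E V f                   ≡⟨ factorCount-cong-degrees E V (λ v∈ → allBut-other (≢u v∈) (≢w v∈)) ⟩
        factorCount E V (const 1)           ∎
      where
        open ≡-Reasoning
        f = allBut u w
        fu≡0 = allBut-left u w
        fw≡0 = allBut-right u w

    private
      without-bw-containing-au : factorCount (bw ∷ E) V⁺ (allBut b w ⊖ au) ≡ factorCount E V (allBut a b)
      without-bw-containing-au = begin
          factorCount (bw ∷ E) V⁺ g     ≡⟨ factorCount-∷-saturated bw E V⁺ g (there (here refl)) (inj₂ refl) gw≡0 ⟩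
          factorCount E V⁺ g            ≡⟨ drop-uw g gu≡0 gw≡0 ⟩
          factorCount E V g             ≡⟨ factorCount-cong-degrees E V (agrees-allBut g ga≡0 gb≡0 g≡1) ⟩
          factorCount E V (allBut a b)  ∎
        where
          open ≡-Reasoning
          g = allBut b w ⊖ au
          gu≡0 = cong₂ _∸_ (allBut-other (λ u≡b → ≢u b∈V (sym u≡b)) u≢w) (incidence-right a u)
          gw≡0 = trans (cong (_∸ incidence w au) (allBut-right b w)) (ℕₚ.0∸n≡0 (incidence w au))
          ga≡0 = cong₂ _∸_ (allBut-other a≢b (≢w a∈V)) (incidence-left a u)
          gb≡0 = trans (cong (_∸ incidence b au) (allBut-left b w)) (ℕₚ.0∸n≡0 (incidence b au))
          g≡1 : ∀ {v} → v ∈ V → v ≢ a → v ≢ b → g v ≡ 1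
          g≡1 v∈ v≢a v≢b = cong₂ _∸_ (allBut-other v≢b (≢w v∈)) (incidence-other v≢a (≢u v∈))

      without-bw-avoiding-au : factorCount (bw ∷ E) V⁺ (allBut b w) ≡ 0
      without-bw-avoiding-au = trans (factorCount-∷-saturated bw E V⁺ _ (there (here refl)) (inj₂ refl) (allBut-right b w))
                                     (stuck-u _ (allBut-other (λ u≡b → ≢u b∈V (sym u≡b)) u≢w))

    factorCount-attach-without-bw : factorCount ((u , w) ∷ (a , u) ∷ (b , w) ∷ E) (u ∷ w ∷ V) (allBut b w) ≡ factorCount E V (allBut a b)
    factorCount-attach-without-bw = begin
        factorCount (uw ∷ au ∷ bw ∷ E) V⁺ f
      ≡⟨ factorCount-∷-saturated uw (au ∷ bw ∷ E) V⁺ f (there (here refl)) (inj₂ refl) (allBut-right b w) ⟩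
        factorCount (au ∷ bw ∷ E) V⁺ f
      ≡⟨ factorCount-∷ au (bw ∷ E) V⁺ f (λ _ → λ { (inj₁ refl) → ℕₚ.≤-reflexive (sym fa≡1) ; (inj₂ refl) → ℕₚ.≤-reflexive (sym fu≡1) }) ⟩
        factorCount (bw ∷ E) V⁺ (f ⊖ au) + factorCount (bw ∷ E) V⁺ f
      ≡⟨ cong₂ _+_ without-bw-containing-au without-bw-avoiding-au ⟩
        factorCount E V (allBut a b) + 0
      ≡⟨ ℕₚ.+-identityʳ _ ⟩
        factorCount E V (allBut a b)
      ∎
      where
        open ≡-Reasoning
        f = allBut b w
        fu≡1 = allBut-other (λ u≡b → ≢u b∈V (sym u≡b)) u≢w
        fa≡1 = allBut-other a≢b (≢w a∈V)

module SnakeGraphs where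

  open FactorCounts using (count; count-++; count-map; count-cong; count-none; count-pos)
  open import Data.Nat as ℕ using (ℕ; suc; _+_; _≤_; _<_; _≥?_; z≤n; s≤s)
  import Data.Nat.Properties as ℕₚ
  open import Data.Bool using (true; false; if_then_else_)
  open import Data.Empty using (⊥; ⊥-elim)
  open import Data.Integer as ℤ using (ℤ; 0ℤ; 1ℤ; -1ℤ; -_)
  open import Data.List using (List; []; _∷_; _++_; _∷ʳ_; map; length; concatMap; reverse)
  import Data.List.Properties as Listₚ
  open import Data.List.Membership.Propositional using (_∈_; _∉_; find)
  open import Data.List.Membership.Propositional.Properties using (∈-++⁻; ∈-++⁺ˡ; ∈-++⁺ʳ; ∈-map⁺; ∈-map⁻; ∈-concatMap⁺; ∈-concatMap⁻)
  open import Data.List.Membership.Propositional.Properties.WithK using (unique∧set⇒bag)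
  open import Data.List.Relation.Unary.Any as Any using (here; there; any?)
  open import Data.List.Relation.Unary.All as All using (All; []; _∷_)
  open import Data.List.Relation.Unary.AllPairs using ([]; _∷_)
  open import Data.List.Relation.Unary.Unique.Propositional using (Unique)
  open import Data.List.Relation.Binary.Permutation.Propositional using (_↭_)
  open import Data.List.Relation.Binary.BagAndSetEquality using (∼bag⇒↭)
  open import Data.Product using (_×_; _,_; proj₁; proj₂; ∃)
  open import Data.Sum as Sum using (_⊎_; inj₁; inj₂)
  open import Function using (_∘_)
  open import Function.Bundles using (_⇔_; mk⇔; Equivalence)
  open import Relation.Nullary using (¬_; Dec; yes; no; does)
  open import Relation.Nullary.Decidable using (dec-true; dec-false)
  open import Relation.Binary.PropositionalEquality

  -- tile i lies between the anti-diagonals x + y = i and x + y = i + 2; comparing levels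
  -- separates the corners and sides of the newest tile from the older ones
  level : Point → ℕ
  level (x , y) = x + y

  level-step : ∀ e p → level (step e p) ≡ suc (level p)
  level-step right (x , y) = refl
  level-step up    (x , y) = ℕₚ.+-suc x y

  step-≢ : ∀ e p → step e p ≢ p
  step-≢ e p eq = ℕₚ.1+n≢n (trans (sym (level-step e p)) (cong level eq))

  step-right≢up : ∀ p → step right p ≢ step up p
  step-right≢up (x , y) eq = ℕₚ.1+n≢n (cong proj₁ eq)

  -- The snake graph reverse rs, built tile by tile: rs lists the directions newest first.
  corner : List Dir → Point
  corner []       = (0 , 0)
  corner (e ∷ rs) = step e (corner rs)

  -- the tiles G₁, G₂, … with the direction through which each was entered (G₁ counts as entered from the left)
  placements : List Dir → List (Point × Dir)
  placements []       = ((0 , 0) , right) ∷ []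
  placements (e ∷ rs) = placements rs ++ (corner (e ∷ rs) , e) ∷ []

  tileCorners : List Dir → List Point
  tileCorners rs = map proj₁ (placements rs)

  sidesOf : Point → List (Point × Side)
  sidesOf p = map (p ,_) sides

  placedSides : List Dir → List (Point × Side)
  placedSides rs = concatMap sidesOf (tileCorners rs)

  tileCorners-∷ : ∀ e rs → tileCorners (e ∷ rs) ≡ tileCorners rs ++ corner (e ∷ rs) ∷ []
  tileCorners-∷ e rs = Listₚ.map-++ proj₁ (placements rs) _

  private
    endFrom : Point → List Dir → Point
    endFrom p []       = p
    endFrom p (d ∷ ds) = endFrom (step d p) ds

    endFrom-∷ʳ : ∀ p ds d → endFrom p (ds ∷ʳ d) ≡ step d (endFrom p ds)
    endFrom-∷ʳ p []       d = refl
    endFrom-∷ʳ p (x ∷ ds) d = endFrom-∷ʳ (step x p) ds d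

    tilesFrom-∷ʳ : ∀ p ds d → tilesFrom p (ds ∷ʳ d) ≡ tilesFrom p ds ∷ʳ step d (endFrom p ds)
    tilesFrom-∷ʳ p []       d = refl
    tilesFrom-∷ʳ p (x ∷ ds) d = cong (p ∷_) (tilesFrom-∷ʳ (step x p) ds d)

    endFrom-reverse : ∀ rs → endFrom (0 , 0) (reverse rs) ≡ corner rs
    endFrom-reverse []       = refl
    endFrom-reverse (e ∷ rs) = begin
        endFrom (0 , 0) (reverse (e ∷ rs))      ≡⟨ cong (endFrom (0 , 0)) (Listₚ.unfold-reverse e rs) ⟩
        endFrom (0 , 0) (reverse rs ∷ʳ e)       ≡⟨ endFrom-∷ʳ (0 , 0) (reverse rs) e ⟩
        step e (endFrom (0 , 0) (reverse rs))   ≡⟨ cong (step e) (endFrom-reverse rs) ⟩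
        corner (e ∷ rs)                         ∎
      where open ≡-Reasoning

  tiles-reverse : ∀ rs → tiles (reverse rs) ≡ tileCorners rs
  tiles-reverse []       = refl
  tiles-reverse (e ∷ rs) = begin
      tilesFrom (0 , 0) (reverse (e ∷ rs))
    ≡⟨ cong (tilesFrom (0 , 0)) (Listₚ.unfold-reverse e rs) ⟩
      tilesFrom (0 , 0) (reverse rs ∷ʳ e)
    ≡⟨ tilesFrom-∷ʳ (0 , 0) (reverse rs) e ⟩
      tiles (reverse rs) ∷ʳ step e (endFrom (0 , 0) (reverse rs))
    ≡⟨ cong₂ (λ ts q → ts ∷ʳ step e q) (tiles-reverse rs) (endFrom-reverse rs) ⟩
      tileCorners rs ∷ʳ corner (e ∷ rs)
    ≡⟨ tileCorners-∷ e rs ⟨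
      tileCorners (e ∷ rs)
    ∎
    where open ≡-Reasoning

  tileSides-reverse : ∀ rs → tileSides (reverse rs) ≡ placedSides rs
  tileSides-reverse rs = cong (concatMap sidesOf) (tiles-reverse rs)

  placements-∷⁻ : ∀ e rs {pd} → pd ∈ placements (e ∷ rs) → pd ∈ placements rs ⊎ pd ≡ (corner (e ∷ rs) , e)
  placements-∷⁻ e rs pd∈ with ∈-++⁻ (placements rs) pd∈
  ... | inj₁ old        = inj₁ old
  ... | inj₂ (here new) = inj₂ new

  tileCorners-∷⁻ : ∀ e rs {p} → p ∈ tileCorners (e ∷ rs) → p ∈ tileCorners rs ⊎ p ≡ corner (e ∷ rs)
  tileCorners-∷⁻ e rs p∈ with ∈-++⁻ (tileCorners rs) (subst (_ ∈_) (tileCorners-∷ e rs) p∈)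
  ... | inj₁ old        = inj₁ old
  ... | inj₂ (here new) = inj₂ new

  tileCorners-∷⁺ : ∀ e rs {p} → p ∈ tileCorners rs → p ∈ tileCorners (e ∷ rs)
  tileCorners-∷⁺ e rs p∈ = subst (_ ∈_) (sym (tileCorners-∷ e rs)) (∈-++⁺ˡ p∈)

  corner∈tileCorners : ∀ rs → corner rs ∈ tileCorners rs
  corner∈tileCorners []       = here refl
  corner∈tileCorners (e ∷ rs) = subst (corner (e ∷ rs) ∈_) (sym (tileCorners-∷ e rs)) (∈-++⁺ʳ (tileCorners rs) (here refl))

  tileCorners⁻ : ∀ rs {p} → p ∈ tileCorners rs → ∃ λ d → (p , d) ∈ placements rs
  tileCorners⁻ rs p∈ with ∈-map⁻ proj₁ p∈
  ... | (p , d) , pd∈ , refl = d , pd∈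

  placedSides⁻ : ∀ rs {p s} → (p , s) ∈ placedSides rs → p ∈ tileCorners rs
  placedSides⁻ rs ps∈ with find (∈-concatMap⁻ sidesOf {xs = tileCorners rs} ps∈)
  ... | p , p∈ , ps∈′ with ∈-map⁻ (p ,_) ps∈′
  ... | _ , _ , refl = p∈

  side∈sides : ∀ s → s ∈ sides
  side∈sides bot = here refl
  side∈sides rgt = there (here refl)
  side∈sides top = there (there (here refl))
  side∈sides lft = there (there (there (here refl)))

  placedSides⁺ : ∀ rs {p} → p ∈ tileCorners rs → ∀ s → (p , s) ∈ placedSides rs
  placedSides⁺ rs p∈ s = ∈-concatMap⁺ sidesOf {xs = tileCorners rs} (Any.map (λ { refl → ∈-map⁺ (_ ,_) (side∈sides s) }) p∈)

  level-corner : ∀ rs → level (corner rs) ≡ length rs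
  level-corner []       = refl
  level-corner (e ∷ rs) = trans (level-step e (corner rs)) (cong suc (level-corner rs))

  tileCorners-level : ∀ rs {p} → p ∈ tileCorners rs → level p ≤ length rs
  tileCorners-level []       (here refl) = z≤n
  tileCorners-level (e ∷ rs) p∈ with tileCorners-∷⁻ e rs p∈
  ... | inj₁ old  = ℕₚ.m≤n⇒m≤1+n (tileCorners-level rs old)
  ... | inj₂ refl = ℕₚ.≤-reflexive (level-corner (e ∷ rs))

  tileCorners-top : ∀ rs {p} → p ∈ tileCorners rs → level p ≡ length rs → p ≡ corner rs
  tileCorners-top []       (here refl) _ = refl
  tileCorners-top (e ∷ rs) p∈ eq with tileCorners-∷⁻ e rs p∈
  ... | inj₁ old  = ⊥-elim (ℕₚ.1+n≰n (subst (_≤ length rs) eq (tileCorners-level rs old)))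
  ... | inj₂ refl = refl

  data Coincide : Point → Side → Point → Side → Set where
    same       : ∀ p s → Coincide p s p s
    right-left : ∀ p → Coincide p rgt (step right p) lft
    top-bottom : ∀ p → Coincide p top (step up p) bot
    left-right : ∀ p → Coincide (step right p) lft p rgt
    bottom-top : ∀ p → Coincide (step up p) bot p top

  seg-coincide : ∀ p s p′ s′ → seg p s ≡ seg p′ s′ → Coincide p s p′ s′
  seg-coincide (x , y) bot (.x , .y) bot refl = same _ _
  seg-coincide (x , .(suc y′)) bot (.x , y′) top refl = bottom-top _
  seg-coincide (x , y) rgt (.x , .y) rgt refl = same _ _
  seg-coincide (x , y) rgt (.(suc x) , .y) lft refl = right-left _
  seg-coincide (x , y) top (.x , .(suc y)) bot refl = top-bottom _
  seg-coincide (x , y) top (.x , .y) top refl = same _ _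
  seg-coincide (.(suc x′) , y) lft (x′ , .y) rgt refl = left-right _
  seg-coincide (x , y) lft (.x , .y) lft refl = same _ _
  seg-coincide (x , y) bot (x′ , y′) rgt ()
  seg-coincide (x , y) bot (x′ , y′) lft ()
  seg-coincide (x , y) rgt (x′ , y′) bot ()
  seg-coincide (x , y) rgt (x′ , y′) top ()
  seg-coincide (x , y) top (x′ , y′) rgt ()
  seg-coincide (x , y) top (x′ , y′) lft ()
  seg-coincide (x , y) lft (x′ , y′) bot ()
  seg-coincide (x , y) lft (x′ , y′) top ()

  seg-injectiveʳ : ∀ p {s s′} → seg p s′ ≡ seg p s → s′ ≡ s
  seg-injectiveʳ p eq = go (seg-coincide p _ p _ eq) refl
    where
      go : ∀ {p s′ p′ s} → Coincide p s′ p′ s → p ≡ p′ → s′ ≡ s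
      go (same _ _)       _  = refl
      go (right-left p)   eq = ⊥-elim (step-≢ right p (sym eq))
      go (top-bottom p)   eq = ⊥-elim (step-≢ up p (sym eq))
      go (left-right p)   eq = ⊥-elim (step-≢ right p eq)
      go (bottom-top p)   eq = ⊥-elim (step-≢ up p eq)

  seg-later : ∀ {p q s t} → level p < level q → seg q t ≡ seg p s →
              (t ≡ lft × s ≡ rgt × q ≡ step right p) ⊎ (t ≡ bot × s ≡ top × q ≡ step up p)
  seg-later {p} {q} lt eq with seg-coincide q _ p _ eq
  ... | same _ _       = ⊥-elim (ℕₚ.<-irrefl refl lt)
  ... | right-left _   = ⊥-elim (ℕₚ.<-asym lt (ℕₚ.≤-reflexive (sym (level-step right q))))
  ... | top-bottom _   = ⊥-elim (ℕₚ.<-asym lt (ℕₚ.≤-reflexive (sym (level-step up q))))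
  ... | left-right _   = inj₁ (refl , refl , refl)
  ... | bottom-top _   = inj₂ (refl , refl , refl)

  frontSide backSide : Dir → Side
  frontSide right = rgt
  frontSide up    = top
  backSide right = lft
  backSide up    = bot

  private
    behind : ∀ e rs {p} → p ∈ tileCorners rs → ∀ d → corner (e ∷ rs) ≡ step d p → p ≡ corner rs × d ≡ e
    behind e rs {p} p∈ d q≡ with tileCorners-top rs p∈ (ℕₚ.suc-injective (trans (sym (level-step d p))
                                   (trans (cong level (sym q≡)) (level-corner (e ∷ rs)))))
    ... | refl = refl , sameDir e d q≡
      where
        sameDir : ∀ e d → step e (corner rs) ≡ step d (corner rs) → d ≡ e
        sameDir right right _  = refl
        sameDir up    up    _  = refl
        sameDir right up    eq = ⊥-elim (step-right≢up _ eq)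
        sameDir up    right eq = ⊥-elim (step-right≢up _ (sym eq))

  newest-meets : ∀ e rs {p s s′} → p ∈ tileCorners rs → seg p s′ ≡ seg (corner (e ∷ rs)) s →
                 p ≡ corner rs × s′ ≡ frontSide e × s ≡ backSide e
  newest-meets e rs {p} p∈ eq
    with seg-later (subst (level p <_) (sym (level-corner (e ∷ rs))) (s≤s (tileCorners-level rs p∈))) (sym eq)
  ... | inj₁ (refl , refl , q≡) with behind e rs p∈ right q≡
  ...   | p≡ , refl = p≡ , refl , refl
  newest-meets e rs {p} p∈ eq
      | inj₂ (refl , refl , q≡) with behind e rs p∈ up q≡
  ...   | p≡ , refl = p≡ , refl , refl

  isSide? : (x : Seg) (ps : Point × Side) → Dec (seg (proj₁ ps) (proj₂ ps) ≡ x)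
  isSide? x ps = seg (proj₁ ps) (proj₂ ps) ≟S x

  sideCount : List Dir → Seg → ℕ
  sideCount rs x = count (isSide? x) (placedSides rs)

  multiplicity-reverse : ∀ rs x → multiplicity (reverse rs) x ≡ sideCount rs x
  multiplicity-reverse rs x = cong (count (isSide? x)) (tileSides-reverse rs)

  sideCount-∷ : ∀ e rs x → sideCount (e ∷ rs) x ≡ sideCount rs x + count (isSide? x) (sidesOf (corner (e ∷ rs)))
  sideCount-∷ e rs x = begin
      count (isSide? x) (concatMap sidesOf (tileCorners (e ∷ rs)))
    ≡⟨ cong (count (isSide? x) ∘ concatMap sidesOf) (tileCorners-∷ e rs) ⟩
      count (isSide? x) (concatMap sidesOf (tileCorners rs ++ q ∷ []))
    ≡⟨ cong (count (isSide? x)) (trans (Listₚ.concatMap-++ sidesOf (tileCorners rs) (q ∷ []))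
                                       (cong (placedSides rs ++_) (Listₚ.++-identityʳ (sidesOf q)))) ⟩
      count (isSide? x) (placedSides rs ++ sidesOf q)
    ≡⟨ count-++ (isSide? x) (placedSides rs) (sidesOf q) ⟩
      sideCount rs x + count (isSide? x) (sidesOf q)
    ∎
    where
      open ≡-Reasoning
      q = corner (e ∷ rs)

  sidesOf-self : ∀ q s → count (isSide? (seg q s)) (sidesOf q) ≡ 1
  sidesOf-self q s = begin
      count (isSide? (seg q s)) (map (q ,_) sides)       ≡⟨ count-map (isSide? (seg q s)) (q ,_) sides ⟩
      count (λ t → seg q t ≟S seg q s) sides             ≡⟨ count-cong (λ t → seg q t ≟S seg q s) (λ t → seg (0 , 0) t ≟S seg (0 , 0) s) sides
                                                              (λ _ → cong (seg (0 , 0)) ∘ seg-injectiveʳ q)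
                                                              (λ _ → cong (seg q) ∘ seg-injectiveʳ (0 , 0)) ⟩
      count (λ t → seg (0 , 0) t ≟S seg (0 , 0) s) sides ≡⟨ once s ⟩
      1                                                  ∎
    where
      open ≡-Reasoning
      once : ∀ s → count (λ t → seg (0 , 0) t ≟S seg (0 , 0) s) sides ≡ 1
      once bot = refl
      once rgt = refl
      once top = refl
      once lft = refl

  sideCount-older : ∀ e rs {p} s → p ∈ tileCorners rs → (∀ d → s ≢ frontSide d) →
                    sideCount (e ∷ rs) (seg p s) ≡ sideCount rs (seg p s)
  sideCount-older e rs {p} s p∈ notFront = begin
      sideCount (e ∷ rs) x                        ≡⟨ sideCount-∷ e rs x ⟩
      sideCount rs x + count (isSide? x) newSides ≡⟨ cong (sideCount rs x +_) (count-none (isSide? x) newSides unshared) ⟩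
      sideCount rs x + 0                          ≡⟨ ℕₚ.+-identityʳ _ ⟩
      sideCount rs x                              ∎
    where
      open ≡-Reasoning
      x = seg p s
      newSides = sidesOf (corner (e ∷ rs))
      unshared : ∀ {x} → x ∈ sidesOf (corner (e ∷ rs)) → ¬ seg (proj₁ x) (proj₂ x) ≡ seg p s
      unshared x∈ eq with ∈-map⁻ (corner (e ∷ rs) ,_) x∈
      ... | t , _ , refl = notFront e (proj₁ (proj₂ (newest-meets e rs p∈ (sym eq))))

  sideCount-newest-fresh : ∀ e rs s → s ≢ backSide e → sideCount (e ∷ rs) (seg (corner (e ∷ rs)) s) ≡ 1
  sideCount-newest-fresh e rs s notBack = begin
      sideCount (e ∷ rs) x                                            ≡⟨ sideCount-∷ e rs x ⟩
      sideCount rs x + count (isSide? x) (sidesOf (corner (e ∷ rs)))  ≡⟨ cong₂ _+_ (count-none (isSide? x) (placedSides rs) unshared)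
                                                                                   (sidesOf-self (corner (e ∷ rs)) s) ⟩
      1                                                               ∎
    where
      open ≡-Reasoning
      x = seg (corner (e ∷ rs)) s
      unshared : ∀ {y} → y ∈ placedSides rs → ¬ seg (proj₁ y) (proj₂ y) ≡ x
      unshared y∈ eq = notBack (proj₂ (proj₂ (newest-meets e rs (placedSides⁻ rs y∈) eq)))

  sideCount-newest-back : ∀ e rs → 2 ≤ sideCount (e ∷ rs) (seg (corner (e ∷ rs)) (backSide e))
  sideCount-newest-back e rs = subst (2 ≤_) (sym (sideCount-∷ e rs x))
    (ℕₚ.+-mono-≤ (count-pos (isSide? x) _ (placedSides⁺ rs (corner∈tileCorners rs) (frontSide e)) (front≡back e (corner rs)))
                 (ℕₚ.≤-reflexive (sym (sidesOf-self (corner (e ∷ rs)) (backSide e)))))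
    where
      x = seg (corner (e ∷ rs)) (backSide e)
      front≡back : ∀ e p → seg p (frontSide e) ≡ seg (step e p) (backSide e)
      front≡back right p = refl
      front≡back up    p = refl

  isInternal-true : ∀ G x → 2 ≤ multiplicity G x → isInternal G x ≡ true
  isInternal-true G x = dec-true (multiplicity G x ≥? 2)

  isInternal-false : ∀ G x → multiplicity G x ≡ 1 → isInternal G x ≡ false
  isInternal-false G x m≡1 = dec-false (multiplicity G x ≥? 2) (λ 2≤m → ℕₚ.1+n≰n (subst (2 ≤_) m≡1 2≤m))

  arcOf-internal : ∀ G p s → isInternal G (seg p s) ≡ true → arcOf G p s ≡ internalArc (seg p s)
  arcOf-internal G p s =
    cong (λ i → if i then internalArc (seg p s) else (if isLeftOfG1 G (seg p s) then flipArc (ccw p s) else ccw p s))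

  arcOf-boundary : ∀ G p s → isInternal G (seg p s) ≡ false → seg p s ≢ seg (0 , 0) lft → arcOf G p s ≡ ccw p s
  arcOf-boundary G p s bdry notLeft =
    cong₂ (λ i l → if i then internalArc (seg p s) else (if l then flipArc (ccw p s) else ccw p s))
          bdry (dec-false (seg p s ≟S seg (0 , 0) lft) notLeft)

  private
    internalArc-by : ∀ e {h} → isHorizontal e ≡ h → internalArc e ≡ (if h then flipArc e else e)
    internalArc-by e = cong (λ h → if h then flipArc e else e)

  internalArc-horizontal : ∀ p s → s ≡ bot ⊎ s ≡ top → internalArc (seg p s) ≡ flipArc (seg p s)
  internalArc-horizontal (x , y) .bot (inj₁ refl) = internalArc-by (seg (x , y) bot) (dec-true (y ℕ.≟ y) refl)
  internalArc-horizontal (x , y) .top (inj₂ refl) = internalArc-by (seg (x , y) top) (dec-true (suc y ℕ.≟ suc y) refl)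

  internalArc-vertical : ∀ p s → s ≡ lft ⊎ s ≡ rgt → internalArc (seg p s) ≡ seg p s
  internalArc-vertical (x , y) .lft (inj₁ refl) = internalArc-by (seg (x , y) lft) (dec-false (y ℕ.≟ suc y) (ℕₚ.<⇒≢ (ℕₚ.n<1+n y)))
  internalArc-vertical (x , y) .rgt (inj₂ refl) = internalArc-by (seg (x , y) rgt) (dec-false (y ℕ.≟ suc y) (ℕₚ.<⇒≢ (ℕₚ.n<1+n y)))

  -- 𝒫 on a tile entered through direction d: counterclockwise except on the back side, which is
  -- the left side of G₁ (rule (3)) or the internal side shared with the previous tile
  tileArc : Dir → Point → Side → Arc
  tileArc d     p rgt = ccw p rgt
  tileArc d     p top = ccw p top
  tileArc right p bot = ccw p bot
  tileArc up    p bot = flipArc (ccw p bot)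
  tileArc right p lft = flipArc (ccw p lft)
  tileArc up    p lft = ccw p lft

  arcOf-rgt : ∀ G p → arcOf G p rgt ≡ ccw p rgt
  arcOf-rgt G (x , y) = by-cases (isInternal G (seg (x , y) rgt)) refl
    where
      by-cases : ∀ b → isInternal G (seg (x , y) rgt) ≡ b → arcOf G (x , y) rgt ≡ ccw (x , y) rgt
      by-cases true  int = trans (arcOf-internal G _ rgt int) (internalArc-vertical _ rgt (inj₂ refl))
      by-cases false int = arcOf-boundary G _ rgt int (λ ())

  arcOf-top : ∀ G p → arcOf G p top ≡ ccw p top
  arcOf-top G (x , y) = by-cases (isInternal G (seg (x , y) top)) refl
    where
      by-cases : ∀ b → isInternal G (seg (x , y) top) ≡ b → arcOf G (x , y) top ≡ ccw (x , y) top
      by-cases true  int = trans (arcOf-internal G _ top int) (internalArc-horizontal _ top (inj₂ refl))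
      by-cases false int = arcOf-boundary G _ top int (λ ())

  arcOf-multiplicity : ∀ G G′ p s → multiplicity G (seg p s) ≡ multiplicity G′ (seg p s) → arcOf G p s ≡ arcOf G′ p s
  arcOf-multiplicity G G′ p s =
    cong (λ m → if does (m ≥? 2) then internalArc (seg p s) else (if isLeftOfG1 G (seg p s) then flipArc (ccw p s) else ccw p s))

  arcOf-older : ∀ e rs {p} s → p ∈ tileCorners rs → (∀ d → s ≢ frontSide d) →
                arcOf (reverse (e ∷ rs)) p s ≡ arcOf (reverse rs) p s
  arcOf-older e rs {p} s p∈ notFront = arcOf-multiplicity (reverse (e ∷ rs)) (reverse rs) p s (begin
      multiplicity (reverse (e ∷ rs)) (seg p s)  ≡⟨ multiplicity-reverse (e ∷ rs) (seg p s) ⟩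
      sideCount (e ∷ rs) (seg p s)               ≡⟨ sideCount-older e rs s p∈ notFront ⟩
      sideCount rs (seg p s)                     ≡⟨ multiplicity-reverse rs (seg p s) ⟨
      multiplicity (reverse rs) (seg p s)        ∎)
    where open ≡-Reasoning

  arcOf-newest-back : ∀ e rs → arcOf (reverse (e ∷ rs)) (corner (e ∷ rs)) (backSide e) ≡ tileArc e (corner (e ∷ rs)) (backSide e)
  arcOf-newest-back e rs = trans (arcOf-internal (reverse (e ∷ rs)) q (backSide e) internal) (shape e)
    where
      q = corner (e ∷ rs)
      internal = isInternal-true (reverse (e ∷ rs)) (seg q (backSide e))
        (subst (2 ≤_) (sym (multiplicity-reverse (e ∷ rs) (seg q (backSide e)))) (sideCount-newest-back e rs))
      shape : ∀ e → internalArc (seg q (backSide e)) ≡ tileArc e q (backSide e)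
      shape right = internalArc-vertical q lft (inj₁ refl)
      shape up    = internalArc-horizontal q bot (inj₁ refl)

  arcOf-newest-fresh : ∀ e rs s → s ≡ bot ⊎ s ≡ lft → s ≢ backSide e →
                       arcOf (reverse (e ∷ rs)) (corner (e ∷ rs)) s ≡ tileArc e (corner (e ∷ rs)) s
  arcOf-newest-fresh e rs s bl notBack =
    trans (arcOf-boundary (reverse (e ∷ rs)) q s boundary (notLeft bl)) (shape e s bl notBack)
    where
      q = corner (e ∷ rs)
      boundary = isInternal-false (reverse (e ∷ rs)) (seg q s)
        (trans (multiplicity-reverse (e ∷ rs) (seg q s)) (sideCount-newest-fresh e rs s notBack))
      notLeft : s ≡ bot ⊎ s ≡ lft → seg q s ≢ seg (0 , 0) lft
      notLeft (inj₁ refl) ()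
      notLeft (inj₂ refl) eq = ℕₚ.1+n≢0 (trans (sym (level-corner (e ∷ rs))) (cong (level ∘ proj₁) eq))
      shape : ∀ e s → s ≡ bot ⊎ s ≡ lft → s ≢ backSide e → ccw q s ≡ tileArc e q s
      shape right .bot (inj₁ refl) _ = refl
      shape up    .lft (inj₂ refl) _ = refl
      shape up    .bot (inj₁ refl) notBack = ⊥-elim (notBack refl)
      shape right .lft (inj₂ refl) notBack = ⊥-elim (notBack refl)

  arcOf-placed : ∀ rs {p d} → (p , d) ∈ placements rs → ∀ s → arcOf (reverse rs) p s ≡ tileArc d p s
  arcOf-placed rs {p} _ rgt = arcOf-rgt (reverse rs) p
  arcOf-placed rs {p} _ top = arcOf-top (reverse rs) p
  arcOf-placed [] (here refl) bot = refl
  arcOf-placed [] (here refl) lft = refl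
  arcOf-placed (e ∷ rs) pd∈ bot with placements-∷⁻ e rs pd∈
  ... | inj₁ old  = trans (arcOf-older e rs bot (∈-map⁺ proj₁ old) (λ { right () ; up () })) (arcOf-placed rs old bot)
  ... | inj₂ refl = older-or-back e
    where
      older-or-back : ∀ e → arcOf (reverse (e ∷ rs)) (corner (e ∷ rs)) bot ≡ tileArc e (corner (e ∷ rs)) bot
      older-or-back right = arcOf-newest-fresh right rs bot (inj₁ refl) (λ ())
      older-or-back up    = arcOf-newest-back up rs
  arcOf-placed (e ∷ rs) pd∈ lft with placements-∷⁻ e rs pd∈
  ... | inj₁ old  = trans (arcOf-older e rs lft (∈-map⁺ proj₁ old) (λ { right () ; up () })) (arcOf-placed rs old lft)
  ... | inj₂ refl = older-or-back e
    where
      older-or-back : ∀ e → arcOf (reverse (e ∷ rs)) (corner (e ∷ rs)) lft ≡ tileArc e (corner (e ∷ rs)) lft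
      older-or-back right = arcOf-newest-back right rs
      older-or-back up    = arcOf-newest-fresh up rs lft (inj₂ refl) (λ ())

  unique-↭ : ∀ {A : Set} {xs ys : List A} → Unique xs → Unique ys →
             (∀ {z} → z ∈ xs → z ∈ ys) → (∀ {z} → z ∈ ys → z ∈ xs) → xs ↭ ys
  unique-↭ uxs uys f g = ∼bag⇒↭ (unique∧set⇒bag uxs uys (mk⇔ f g))

  module _ {A : Set} (_≟_ : (a b : A) → Dec (a ≡ b)) where

    dedup-∈⁻ : ∀ xs {x} → x ∈ dedup _≟_ xs → x ∈ xs
    dedup-∈⁻ (a ∷ as) x∈ with any? (_≟_ a) as
    ... | yes _ = there (dedup-∈⁻ as x∈)
    dedup-∈⁻ (a ∷ as) (here x≡a)  | no _ = here x≡a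
    dedup-∈⁻ (a ∷ as) (there x∈)  | no _ = there (dedup-∈⁻ as x∈)

    dedup-∈⁺ : ∀ xs {x} → x ∈ xs → x ∈ dedup _≟_ xs
    dedup-∈⁺ (a ∷ as) x∈ with any? (_≟_ a) as
    dedup-∈⁺ (a ∷ as) (here refl) | yes a∈ = dedup-∈⁺ as a∈
    dedup-∈⁺ (a ∷ as) (there x∈)  | yes _  = dedup-∈⁺ as x∈
    dedup-∈⁺ (a ∷ as) (here x≡a)  | no _   = here x≡a
    dedup-∈⁺ (a ∷ as) (there x∈)  | no _   = there (dedup-∈⁺ as x∈)

    dedup-unique : ∀ xs → Unique (dedup _≟_ xs)
    dedup-unique []       = []
    dedup-unique (a ∷ as) with any? (_≟_ a) as
    ... | yes _  = dedup-unique as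
    ... | no a∉ = All.tabulate (λ z∈ a≡z → a∉ (subst (_∈ as) (sym a≡z) (dedup-∈⁻ as z∈))) ∷ dedup-unique as

  opposite : Point → Point
  opposite (x , y) = (suc x , suc y)

  corners : Point → List Point
  corners (x , y) = (x , y) ∷ (suc x , y) ∷ (x , suc y) ∷ (suc x , suc y) ∷ []

  lastDir : List Dir → Dir
  lastDir []      = right
  lastDir (e ∷ _) = e

  -- the two vertices contributed by the newest tile (for G₁ alone: its right corners)
  U W : List Dir → Point
  U rs = step (lastDir rs) (corner rs)
  W rs = opposite (corner rs)

  vertexList : List Dir → List Point
  vertexList []       = U [] ∷ W [] ∷ (0 , 0) ∷ (0 , 1) ∷ []
  vertexList (e ∷ rs) = U (e ∷ rs) ∷ W (e ∷ rs) ∷ vertexList rs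

  IsCorner : List Dir → Point → Set
  IsCorner rs v = ∃ λ p → p ∈ tileCorners rs × v ∈ corners p

  vertexList⇒IsCorner : ∀ rs {v} → v ∈ vertexList rs → IsCorner rs v
  vertexList⇒IsCorner []           (here refl)                         = _ , here refl , there (here refl)
  vertexList⇒IsCorner []           (there (here refl))                 = _ , here refl , there (there (there (here refl)))
  vertexList⇒IsCorner []           (there (there (here refl)))         = _ , here refl , here refl
  vertexList⇒IsCorner []           (there (there (there (here refl)))) = _ , here refl , there (there (here refl))
  vertexList⇒IsCorner (right ∷ rs) (here refl)         = _ , corner∈tileCorners (right ∷ rs) , there (here refl)
  vertexList⇒IsCorner (up ∷ rs)    (here refl)         = _ , corner∈tileCorners (up ∷ rs) , there (there (here refl))
  vertexList⇒IsCorner (e ∷ rs)     (there (here refl)) = _ , corner∈tileCorners (e ∷ rs) , there (there (there (here refl)))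
  vertexList⇒IsCorner (e ∷ rs)     (there (there v∈)) with vertexList⇒IsCorner rs v∈
  ... | p , p∈ , c = p , tileCorners-∷⁺ e rs p∈ , c

  IsCorner⇒vertexList : ∀ rs {v} → IsCorner rs v → v ∈ vertexList rs
  IsCorner⇒vertexList [] (_ , here refl , here refl)                         = there (there (here refl))
  IsCorner⇒vertexList [] (_ , here refl , there (here refl))                 = here refl
  IsCorner⇒vertexList [] (_ , here refl , there (there (here refl)))         = there (there (there (here refl)))
  IsCorner⇒vertexList [] (_ , here refl , there (there (there (here refl)))) = there (here refl)
  IsCorner⇒vertexList (e ∷ rs) (p , p∈ , c) with tileCorners-∷⁻ e rs p∈
  ... | inj₁ old = there (there (IsCorner⇒vertexList rs (p , old , c)))
  IsCorner⇒vertexList (right ∷ rs) (p , p∈ , here refl) | inj₂ refl =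
    there (there (IsCorner⇒vertexList rs (_ , corner∈tileCorners rs , there (here refl))))
  IsCorner⇒vertexList (right ∷ rs) (p , p∈ , there (here refl)) | inj₂ refl = here refl
  IsCorner⇒vertexList (right ∷ rs) (p , p∈ , there (there (here refl))) | inj₂ refl =
    there (there (IsCorner⇒vertexList rs (_ , corner∈tileCorners rs , there (there (there (here refl))))))
  IsCorner⇒vertexList (right ∷ rs) (p , p∈ , there (there (there (here refl)))) | inj₂ refl = there (here refl)
  IsCorner⇒vertexList (up ∷ rs) (p , p∈ , here refl) | inj₂ refl =
    there (there (IsCorner⇒vertexList rs (_ , corner∈tileCorners rs , there (there (here refl)))))
  IsCorner⇒vertexList (up ∷ rs) (p , p∈ , there (here refl)) | inj₂ refl =
    there (there (IsCorner⇒vertexList rs (_ , corner∈tileCorners rs , there (there (there (here refl))))))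
  IsCorner⇒vertexList (up ∷ rs) (p , p∈ , there (there (here refl))) | inj₂ refl = here refl
  IsCorner⇒vertexList (up ∷ rs) (p , p∈ , there (there (there (here refl)))) | inj₂ refl = there (here refl)

  level-opposite : ∀ p → level (opposite p) ≡ 2 + level p
  level-opposite (x , y) = cong suc (ℕₚ.+-suc x y)

  corners-level : ∀ p {v} → v ∈ corners p → level v ≤ 2 + level p
  corners-level (x , y) (here refl)                         = ℕₚ.≤-trans (ℕₚ.n≤1+n _) (ℕₚ.n≤1+n _)
  corners-level (x , y) (there (here refl))                 = ℕₚ.n≤1+n _
  corners-level (x , y) (there (there (here refl)))         = ℕₚ.≤-trans (ℕₚ.≤-reflexive (ℕₚ.+-suc x y)) (ℕₚ.n≤1+n _)
  corners-level (x , y) (there (there (there (here refl)))) = ℕₚ.≤-reflexive (level-opposite (x , y))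

  corners-bottom : ∀ p {v} → v ∈ corners p → level v ≡ level p → v ≡ p
  corners-bottom (x , y) (here refl)                         _  = refl
  corners-bottom (x , y) (there (here refl))                 eq = ⊥-elim (ℕₚ.1+n≢n eq)
  corners-bottom (x , y) (there (there (here refl)))         eq = ⊥-elim (ℕₚ.1+n≢n (trans (sym (ℕₚ.+-suc x y)) eq))
  corners-bottom (x , y) (there (there (there (here refl)))) eq =
    ⊥-elim (ℕₚ.1+n≰n (ℕₚ.≤-trans (ℕₚ.n≤1+n _) (ℕₚ.≤-reflexive (trans (sym (level-opposite (x , y))) eq))))

  corners-top : ∀ p {v} → v ∈ corners p → level v ≡ 2 + level p → v ≡ opposite p
  corners-top (x , y) (here refl)                         eq = ⊥-elim (ℕₚ.1+n≰n (ℕₚ.≤-trans (ℕₚ.≤-reflexive (sym eq)) (ℕₚ.n≤1+n _)))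
  corners-top (x , y) (there (here refl))                 eq = ⊥-elim (ℕₚ.1+n≢n (sym (ℕₚ.suc-injective eq)))
  corners-top (x , y) (there (there (here refl)))         eq = ⊥-elim (ℕₚ.1+n≢n (sym (ℕₚ.suc-injective (trans (sym (ℕₚ.+-suc x y)) eq))))
  corners-top (x , y) (there (there (there (here refl)))) _  = refl

  vertexList-level : ∀ rs {v} → v ∈ vertexList rs → level v ≤ 2 + length rs
  vertexList-level rs v∈ with vertexList⇒IsCorner rs v∈
  ... | p , p∈ , c = ℕₚ.≤-trans (corners-level p c) (s≤s (s≤s (tileCorners-level rs p∈)))

  vertexList-top : ∀ rs {v} → v ∈ vertexList rs → level v ≡ 2 + length rs → v ≡ W rs
  vertexList-top rs v∈ eq with vertexList⇒IsCorner rs v∈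
  ... | p , p∈ , c with ℕₚ.m≤n⇒m<n∨m≡n (tileCorners-level rs p∈)
  ...   | inj₁ lt = ⊥-elim (ℕₚ.<-irrefl eq (ℕₚ.≤-trans (s≤s (corners-level p c)) (s≤s (s≤s lt))))
  ...   | inj₂ topmost with tileCorners-top rs p∈ topmost
  ...     | refl = corners-top p c (trans eq (cong (suc ∘ suc) (sym topmost)))

  level-U : ∀ rs → level (U rs) ≡ 1 + length rs
  level-U rs = trans (level-step (lastDir rs) (corner rs)) (cong suc (level-corner rs))

  level-W : ∀ rs → level (W rs) ≡ 2 + length rs
  level-W rs = trans (level-opposite (corner rs)) (cong (suc ∘ suc) (level-corner rs))

  U≢W : ∀ rs → U rs ≢ W rs
  U≢W rs eq = ℕₚ.1+n≢n (trans (sym (level-W rs)) (trans (cong level (sym eq)) (level-U rs)))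

  W-fresh : ∀ e rs → W (e ∷ rs) ∉ vertexList rs
  W-fresh e rs w∈ = ℕₚ.1+n≰n (subst (_≤ 2 + length rs) (level-W (e ∷ rs)) (vertexList-level rs w∈))

  U-fresh : ∀ e rs → U (e ∷ rs) ∉ vertexList rs
  U-fresh e rs u∈ = U≢topmost e (vertexList-top rs u∈ (level-U (e ∷ rs)))
    where
      U≢topmost : ∀ e → U (e ∷ rs) ≢ W rs
      U≢topmost right eq = ℕₚ.1+n≢n (sym (cong proj₂ eq))
      U≢topmost up    eq = ℕₚ.1+n≢n (sym (cong proj₁ eq))

  vertexList-unique : ∀ rs → Unique (vertexList rs)
  vertexList-unique [] = ((λ ()) ∷ (λ ()) ∷ (λ ()) ∷ []) ∷ ((λ ()) ∷ (λ ()) ∷ []) ∷ ((λ ()) ∷ []) ∷ [] ∷ []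
  vertexList-unique (e ∷ rs) =
      (U≢W (e ∷ rs) ∷ All.tabulate (λ v∈ U≡v → U-fresh e rs (subst (_∈ vertexList rs) (sym U≡v) v∈)))
    ∷ All.tabulate (λ v∈ W≡v → W-fresh e rs (subst (_∈ vertexList rs) (sym W≡v) v∈))
    ∷ vertexList-unique rs

  endpoints : Seg → List Point
  endpoints e = proj₁ e ∷ proj₂ e ∷ []

  seg-endpoints : ∀ p s {v} → v ∈ endpoints (seg p s) → v ∈ corners p
  seg-endpoints (x , y) bot (here refl)         = here refl
  seg-endpoints (x , y) bot (there (here refl)) = there (here refl)
  seg-endpoints (x , y) rgt (here refl)         = there (here refl)
  seg-endpoints (x , y) rgt (there (here refl)) = there (there (there (here refl)))
  seg-endpoints (x , y) top (here refl)         = there (there (here refl))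
  seg-endpoints (x , y) top (there (here refl)) = there (there (there (here refl)))
  seg-endpoints (x , y) lft (here refl)         = here refl
  seg-endpoints (x , y) lft (there (here refl)) = there (there (here refl))

  corners-endpoints : ∀ p {v} → v ∈ corners p → ∃ λ s → v ∈ endpoints (seg p s)
  corners-endpoints (x , y) (here refl)                         = bot , here refl
  corners-endpoints (x , y) (there (here refl))                 = bot , there (here refl)
  corners-endpoints (x , y) (there (there (here refl)))         = lft , there (here refl)
  corners-endpoints (x , y) (there (there (there (here refl)))) = rgt , there (here refl)

  IsSide : List Dir → Seg → Set
  IsSide rs x = ∃ λ p → ∃ λ s → p ∈ tileCorners rs × seg p s ≡ x

  edges⇒IsSide : ∀ rs {x} → x ∈ edges (reverse rs) → IsSide rs x
  edges⇒IsSide rs x∈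
    with ∈-map⁻ _ (subst (_ ∈_) (cong (map (λ ps → seg (proj₁ ps) (proj₂ ps))) (tileSides-reverse rs)) (dedup-∈⁻ _≟S_ _ x∈))
  ... | (p , s) , ps∈ , refl = p , s , placedSides⁻ rs ps∈ , refl

  IsSide⇒edges : ∀ rs {x} → IsSide rs x → x ∈ edges (reverse rs)
  IsSide⇒edges rs (p , s , p∈ , refl) = dedup-∈⁺ _≟S_ _
    (subst (_ ∈_) (sym (cong (map (λ ps → seg (proj₁ ps) (proj₂ ps))) (tileSides-reverse rs)))
           (∈-map⁺ (λ ps → seg (proj₁ ps) (proj₂ ps)) (placedSides⁺ rs p∈ s)))

  vertices⇒vertexList : ∀ rs {v} → v ∈ vertices (reverse rs) → v ∈ vertexList rs
  vertices⇒vertexList rs v∈ with find (∈-concatMap⁻ endpoints {xs = edges (reverse rs)} (dedup-∈⁻ _≟P_ _ v∈))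
  ... | x , x∈ , v∈x with edges⇒IsSide rs x∈
  ...   | p , s , p∈ , refl = IsCorner⇒vertexList rs (p , p∈ , seg-endpoints p s v∈x)

  vertexList⇒vertices : ∀ rs {v} → v ∈ vertexList rs → v ∈ vertices (reverse rs)
  vertexList⇒vertices rs v∈ with vertexList⇒IsCorner rs v∈
  ... | p , p∈ , c with corners-endpoints p c
  ...   | s , v∈x = dedup-∈⁺ _≟P_ _ (∈-concatMap⁺ endpoints {xs = edges (reverse rs)}
                      (Any.map (λ { refl → v∈x }) (IsSide⇒edges rs (p , s , p∈ , refl))))

  vertices-↭ : ∀ rs → vertices (reverse rs) ↭ vertexList rs
  vertices-↭ rs = unique-↭ (dedup-unique _≟P_ (concatMap endpoints (edges (reverse rs)))) (vertexList-unique rs)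
                           (vertices⇒vertexList rs) (vertexList⇒vertices rs)

  -- each tile after G₁ adds the three sides other than its back side
  newSides : Dir → Point → List Seg
  newSides right q = seg q rgt ∷ seg q bot ∷ seg q top ∷ []
  newSides up    q = seg q top ∷ seg q lft ∷ seg q rgt ∷ []

  edgeList : List Dir → List Seg
  edgeList []       = seg (0 , 0) rgt ∷ seg (0 , 0) bot ∷ seg (0 , 0) top ∷ seg (0 , 0) lft ∷ []
  edgeList (e ∷ rs) = newSides e (corner (e ∷ rs)) ++ edgeList rs

  edgeList⇒IsSide : ∀ rs {x} → x ∈ edgeList rs → IsSide rs x
  edgeList⇒IsSide []           (here refl)                         = _ , rgt , here refl , refl
  edgeList⇒IsSide []           (there (here refl))                 = _ , bot , here refl , refl
  edgeList⇒IsSide []           (there (there (here refl)))         = _ , top , here refl , refl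
  edgeList⇒IsSide []           (there (there (there (here refl)))) = _ , lft , here refl , refl
  edgeList⇒IsSide (right ∷ rs) (here refl)                 = _ , rgt , corner∈tileCorners (right ∷ rs) , refl
  edgeList⇒IsSide (right ∷ rs) (there (here refl))         = _ , bot , corner∈tileCorners (right ∷ rs) , refl
  edgeList⇒IsSide (right ∷ rs) (there (there (here refl))) = _ , top , corner∈tileCorners (right ∷ rs) , refl
  edgeList⇒IsSide (up ∷ rs)    (here refl)                 = _ , top , corner∈tileCorners (up ∷ rs) , refl
  edgeList⇒IsSide (up ∷ rs)    (there (here refl))         = _ , lft , corner∈tileCorners (up ∷ rs) , refl
  edgeList⇒IsSide (up ∷ rs)    (there (there (here refl))) = _ , rgt , corner∈tileCorners (up ∷ rs) , refl
  edgeList⇒IsSide (right ∷ rs) (there (there (there x∈))) with edgeList⇒IsSide rs x∈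
  ... | p , s , p∈ , eq = p , s , tileCorners-∷⁺ right rs p∈ , eq
  edgeList⇒IsSide (up ∷ rs)    (there (there (there x∈))) with edgeList⇒IsSide rs x∈
  ... | p , s , p∈ , eq = p , s , tileCorners-∷⁺ up rs p∈ , eq

  IsSide⇒edgeList : ∀ rs {x} → IsSide rs x → x ∈ edgeList rs
  IsSide⇒edgeList [] (_ , rgt , here refl , refl) = here refl
  IsSide⇒edgeList [] (_ , bot , here refl , refl) = there (here refl)
  IsSide⇒edgeList [] (_ , top , here refl , refl) = there (there (here refl))
  IsSide⇒edgeList [] (_ , lft , here refl , refl) = there (there (there (here refl)))
  IsSide⇒edgeList (e ∷ rs) (p , s , p∈ , refl) with tileCorners-∷⁻ e rs p∈
  ... | inj₁ old = ∈-++⁺ʳ (newSides e (corner (e ∷ rs))) (IsSide⇒edgeList rs (p , s , old , refl))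
  IsSide⇒edgeList (right ∷ rs) (p , rgt , p∈ , refl) | inj₂ refl = here refl
  IsSide⇒edgeList (right ∷ rs) (p , bot , p∈ , refl) | inj₂ refl = there (here refl)
  IsSide⇒edgeList (right ∷ rs) (p , top , p∈ , refl) | inj₂ refl = there (there (here refl))
  IsSide⇒edgeList (right ∷ rs) (p , lft , p∈ , refl) | inj₂ refl =
    there (there (there (IsSide⇒edgeList rs (corner rs , rgt , corner∈tileCorners rs , refl))))
  IsSide⇒edgeList (up ∷ rs) (p , top , p∈ , refl) | inj₂ refl = here refl
  IsSide⇒edgeList (up ∷ rs) (p , lft , p∈ , refl) | inj₂ refl = there (here refl)
  IsSide⇒edgeList (up ∷ rs) (p , rgt , p∈ , refl) | inj₂ refl = there (there (here refl))
  IsSide⇒edgeList (up ∷ rs) (p , bot , p∈ , refl) | inj₂ refl =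
    there (there (there (IsSide⇒edgeList rs (corner rs , top , corner∈tileCorners rs , refl))))

  private
    newest-side-fresh : ∀ e rs s → s ≢ backSide e → seg (corner (e ∷ rs)) s ∉ edgeList rs
    newest-side-fresh e rs s notBack x∈ with edgeList⇒IsSide rs x∈
    ... | p , s′ , p∈ , eq = notBack (proj₂ (proj₂ (newest-meets e rs p∈ eq)))

    distinct-sides : ∀ q s t → s ≢ t → seg q s ≢ seg q t
    distinct-sides q s t s≢t eq = s≢t (seg-injectiveʳ q eq)

    ∉⇒All≢ : ∀ {A : Set} {x : A} {xs} → x ∉ xs → All (x ≢_) xs
    ∉⇒All≢ x∉ = All.tabulate (λ y∈ x≡y → x∉ (subst (_∈ _) (sym x≡y) y∈))

  edgeList-unique : ∀ rs → Unique (edgeList rs)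
  edgeList-unique [] = ((λ ()) ∷ (λ ()) ∷ (λ ()) ∷ []) ∷ ((λ ()) ∷ (λ ()) ∷ []) ∷ ((λ ()) ∷ []) ∷ [] ∷ []
  edgeList-unique (right ∷ rs) =
      (distinct-sides q rgt bot (λ ()) ∷ distinct-sides q rgt top (λ ()) ∷ ∉⇒All≢ (newest-side-fresh right rs rgt (λ ())))
    ∷ (distinct-sides q bot top (λ ()) ∷ ∉⇒All≢ (newest-side-fresh right rs bot (λ ())))
    ∷ ∉⇒All≢ (newest-side-fresh right rs top (λ ()))
    ∷ edgeList-unique rs
    where q = corner (right ∷ rs)
  edgeList-unique (up ∷ rs) =
      (distinct-sides q top lft (λ ()) ∷ distinct-sides q top rgt (λ ()) ∷ ∉⇒All≢ (newest-side-fresh up rs top (λ ())))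
    ∷ (distinct-sides q lft rgt (λ ()) ∷ ∉⇒All≢ (newest-side-fresh up rs lft (λ ())))
    ∷ ∉⇒All≢ (newest-side-fresh up rs rgt (λ ()))
    ∷ edgeList-unique rs
    where q = corner (up ∷ rs)

  edges-↭ : ∀ rs → edges (reverse rs) ↭ edgeList rs
  edges-↭ rs = unique-↭ (dedup-unique _≟S_ (map (λ ps → seg (proj₁ ps) (proj₂ ps)) (tileSides (reverse rs)))) (edgeList-unique rs)
    (IsSide⇒edgeList rs ∘ edges⇒IsSide rs) (IsSide⇒edges rs ∘ edgeList⇒IsSide rs)

  edgeList-endpoints : ∀ rs {x} → x ∈ edgeList rs → proj₁ x ∈ vertexList rs × proj₂ x ∈ vertexList rs
  edgeList-endpoints rs x∈ with edgeList⇒IsSide rs x∈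
  ... | p , s , p∈ , refl = IsCorner⇒vertexList rs (p , p∈ , seg-endpoints p s (here refl))
                          , IsCorner⇒vertexList rs (p , p∈ , seg-endpoints p s (there (here refl)))

  module _ {A : List Arc} {u v : Point} where

    bEntry-forward : (u , v) ∈ A → bEntry A u v ≡ 1ℤ
    bEntry-forward uv∈ with any? (_≟A_ (u , v)) A
    ... | yes _   = refl
    ... | no uv∉ = ⊥-elim (uv∉ uv∈)

    bEntry-backward : (u , v) ∉ A → (v , u) ∈ A → bEntry A u v ≡ -1ℤ
    bEntry-backward uv∉ vu∈ with any? (_≟A_ (u , v)) A
    ... | yes uv∈ = ⊥-elim (uv∉ uv∈)
    ... | no _ with any? (_≟A_ (v , u)) A
    ...   | yes _   = refl
    ...   | no vu∉ = ⊥-elim (vu∉ vu∈)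

    bEntry-none : (u , v) ∉ A → (v , u) ∉ A → bEntry A u v ≡ 0ℤ
    bEntry-none uv∉ vu∉ with any? (_≟A_ (u , v)) A
    ... | yes uv∈ = ⊥-elim (uv∉ uv∈)
    ... | no _ with any? (_≟A_ (v , u)) A
    ...   | yes vu∈ = ⊥-elim (vu∉ vu∈)
    ...   | no _    = refl

  bEntry-cong : ∀ {A A′ u v} → (u , v) ∈ A ⇔ (u , v) ∈ A′ → (v , u) ∈ A ⇔ (v , u) ∈ A′ → bEntry A u v ≡ bEntry A′ u v
  bEntry-cong {A} {A′} {u} {v} uv vu = by-cases (any? (_≟A_ (u , v)) A) (any? (_≟A_ (v , u)) A)
    where
      open Equivalence
      by-cases : Dec ((u , v) ∈ A) → Dec ((v , u) ∈ A) → bEntry A u v ≡ bEntry A′ u v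
      by-cases (yes uv∈) _        = trans (bEntry-forward uv∈) (sym (bEntry-forward (to uv uv∈)))
      by-cases (no uv∉)  (yes vu∈) = trans (bEntry-backward uv∉ vu∈) (sym (bEntry-backward (uv∉ ∘ from uv) (to vu vu∈)))
      by-cases (no uv∉)  (no vu∉)  = trans (bEntry-none uv∉ vu∉) (sym (bEntry-none (uv∉ ∘ from uv) (vu∉ ∘ from vu)))

  Antisymmetric : List Arc → Set
  Antisymmetric A = ∀ {u v} → (u , v) ∈ A → (v , u) ∈ A → ⊥

  bEntry-skew : ∀ {A} → Antisymmetric A → ∀ u v → bEntry A u v ≡ - bEntry A v u
  bEntry-skew {A} antisym u v = by-cases (any? (_≟A_ (u , v)) A) (any? (_≟A_ (v , u)) A)
    where
      by-cases : Dec ((u , v) ∈ A) → Dec ((v , u) ∈ A) → bEntry A u v ≡ - bEntry A v u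
      by-cases (yes uv∈) (yes vu∈) = ⊥-elim (antisym uv∈ vu∈)
      by-cases (yes uv∈) (no vu∉)  = trans (bEntry-forward uv∈) (cong -_ (sym (bEntry-backward vu∉ uv∈)))
      by-cases (no uv∉)  (yes vu∈) = trans (bEntry-backward uv∉ vu∈) (cong -_ (sym (bEntry-forward vu∈)))
      by-cases (no uv∉)  (no vu∉)  = trans (bEntry-none uv∉ vu∉) (cong -_ (sym (bEntry-none vu∉ uv∉)))

  tileArcs : Point × Dir → List Arc
  tileArcs (p , d) = map (tileArc d p) sides

  -- 𝒫(reverse rs), listed tile by tile
  arcList : List Dir → List Arc
  arcList rs = concatMap tileArcs (placements rs)

  private
    arcsOf-placements : ∀ G (L : List (Point × Dir)) → (∀ {p d} → (p , d) ∈ L → ∀ s → arcOf G p s ≡ tileArc d p s) →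
                        map (λ ps → arcOf G (proj₁ ps) (proj₂ ps)) (concatMap sidesOf (map proj₁ L)) ≡ concatMap tileArcs L
    arcsOf-placements G []            _  = refl
    arcsOf-placements G ((p , d) ∷ L) h = trans (Listₚ.map-++ F (sidesOf p) (concatMap sidesOf (map proj₁ L)))
      (cong₂ _++_ (trans (sym (Listₚ.map-∘ {g = F} {f = p ,_} sides)) (Listₚ.map-cong {f = arcOf G p} {g = tileArc d p} (h (here refl)) sides))
                  (arcsOf-placements G L (h ∘ there)))
      where
        F = λ ps → arcOf G (proj₁ ps) (proj₂ ps)

    orientation-arcs : ∀ rs → map (λ ps → arcOf (reverse rs) (proj₁ ps) (proj₂ ps)) (tileSides (reverse rs)) ≡ arcList rs
    orientation-arcs rs = trans (cong (map _) (tileSides-reverse rs)) (arcsOf-placements (reverse rs) (placements rs) (arcOf-placed rs))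

  orientation⇔arcList : ∀ rs {a} → a ∈ orientation (reverse rs) ⇔ a ∈ arcList rs
  orientation⇔arcList rs = mk⇔ (subst (_ ∈_) (orientation-arcs rs) ∘ dedup-∈⁻ _≟A_ _)
                               (dedup-∈⁺ _≟A_ _ ∘ subst (_ ∈_) (sym (orientation-arcs rs)))

  bEntry-orientation : ∀ rs u v → bEntry (orientation (reverse rs)) u v ≡ bEntry (arcList rs) u v
  bEntry-orientation rs u v = bEntry-cong (orientation⇔arcList rs) (orientation⇔arcList rs)

  arcList-∷ : ∀ e rs → arcList (e ∷ rs) ≡ arcList rs ++ tileArcs (corner (e ∷ rs) , e)
  arcList-∷ e rs = trans (Listₚ.concatMap-++ tileArcs (placements rs) _) (cong (arcList rs ++_) (Listₚ.++-identityʳ _))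

  arcList-∷⁻ : ∀ e rs {a} → a ∈ arcList (e ∷ rs) → a ∈ arcList rs ⊎ a ∈ tileArcs (corner (e ∷ rs) , e)
  arcList-∷⁻ e rs = ∈-++⁻ (arcList rs) ∘ subst (_ ∈_) (arcList-∷ e rs)

  arcList-∷⁺ˡ : ∀ e rs {a} → a ∈ arcList rs → a ∈ arcList (e ∷ rs)
  arcList-∷⁺ˡ e rs = subst (_ ∈_) (sym (arcList-∷ e rs)) ∘ ∈-++⁺ˡ

  arcList-∷⁺ʳ : ∀ e rs {a} → a ∈ tileArcs (corner (e ∷ rs) , e) → a ∈ arcList (e ∷ rs)
  arcList-∷⁺ʳ e rs = subst (_ ∈_) (sym (arcList-∷ e rs)) ∘ ∈-++⁺ʳ (arcList rs)

  tileArcs⁻ : ∀ p d {a} → a ∈ tileArcs (p , d) → ∃ λ s → a ≡ tileArc d p s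
  tileArcs⁻ p d a∈ with ∈-map⁻ (tileArc d p) {xs = sides} a∈
  ... | s , _ , eq = s , eq

  tileArc-seg : ∀ d p s → tileArc d p s ≡ seg p s ⊎ tileArc d p s ≡ flipArc (seg p s)
  tileArc-seg d     (x , y) rgt = inj₁ refl
  tileArc-seg d     (x , y) top = inj₂ refl
  tileArc-seg right (x , y) bot = inj₁ refl
  tileArc-seg up    (x , y) bot = inj₂ refl
  tileArc-seg right (x , y) lft = inj₁ refl
  tileArc-seg up    (x , y) lft = inj₂ refl

  tileArc-endpoints : ∀ d p s → proj₁ (tileArc d p s) ∈ corners p × proj₂ (tileArc d p s) ∈ corners p
  tileArc-endpoints d p s with tileArc-seg d p s
  ... | inj₁ eq = subst (λ a → proj₁ a ∈ corners p × proj₂ a ∈ corners p) (sym eq)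
                        (seg-endpoints p s (here refl) , seg-endpoints p s (there (here refl)))
  ... | inj₂ eq = subst (λ a → proj₁ a ∈ corners p × proj₂ a ∈ corners p) (sym eq)
                        (seg-endpoints p s (there (here refl)) , seg-endpoints p s (here refl))

  arcList-endpoints : ∀ rs {u v} → (u , v) ∈ arcList rs → u ∈ vertexList rs × v ∈ vertexList rs
  arcList-endpoints rs a∈ with find (∈-concatMap⁻ tileArcs {xs = placements rs} a∈)
  ... | (p , d) , pd∈ , a∈′ with tileArcs⁻ p d a∈′
  ...   | s , refl = IsCorner⇒vertexList rs (p , ∈-map⁺ proj₁ pd∈ , proj₁ (tileArc-endpoints d p s))
                   , IsCorner⇒vertexList rs (p , ∈-map⁺ proj₁ pd∈ , proj₂ (tileArc-endpoints d p s))

  seg-level : ∀ p s → level (proj₂ (seg p s)) ≡ suc (level (proj₁ (seg p s)))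
  seg-level (x , y) bot = refl
  seg-level (x , y) rgt = ℕₚ.+-suc (suc x) y
  seg-level (x , y) top = refl
  seg-level (x , y) lft = ℕₚ.+-suc x y

  seg-increasing : ∀ p s → level (proj₁ (seg p s)) < level (proj₂ (seg p s))
  seg-increasing p s = ℕₚ.≤-reflexive (sym (seg-level p s))

  -- the sides of a tile are distinct segments, each stored from its lower end
  tileArcs-antisymmetric : ∀ p d → Antisymmetric (tileArcs (p , d))
  tileArcs-antisymmetric p d {a} {b} ab∈ ba∈ with tileArcs⁻ p d ab∈ | tileArcs⁻ p d ba∈
  ... | s , ab≡ | t , ba≡ = by-cases (tileArc-seg d p s) (tileArc-seg d p t)
    where
      increasing : ∀ {x y} r → (x , y) ≡ seg p r → level x < level y
      increasing r eq = subst (λ z → level (proj₁ z) < level (proj₂ z)) (sym eq) (seg-increasing p r)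
      same-side : ∀ {x y} → (x , y) ≡ seg p s → (x , y) ≡ seg p t → level a ≡ level b
      same-side s≡ t≡ with seg-injectiveʳ p (trans (sym t≡) s≡)
      ... | refl = cong (level ∘ proj₁) (trans ab≡ (sym ba≡))
      by-cases : tileArc d p s ≡ seg p s ⊎ tileArc d p s ≡ flipArc (seg p s) →
                 tileArc d p t ≡ seg p t ⊎ tileArc d p t ≡ flipArc (seg p t) → ⊥
      by-cases (inj₁ s≡) (inj₁ t≡) = ℕₚ.<-asym (increasing s (trans ab≡ s≡)) (increasing t (trans ba≡ t≡))
      by-cases (inj₂ s≡) (inj₂ t≡) = ℕₚ.<-asym (increasing t (cong flipArc (trans ba≡ t≡))) (increasing s (cong flipArc (trans ab≡ s≡)))
      by-cases (inj₁ s≡) (inj₂ t≡) =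
        ℕₚ.<-irrefl (same-side (trans ab≡ s≡) (cong flipArc (trans ba≡ t≡))) (increasing s (trans ab≡ s≡))
      by-cases (inj₂ s≡) (inj₁ t≡) =
        ℕₚ.<-irrefl (sym (same-side (cong flipArc (trans ab≡ s≡)) (trans ba≡ t≡))) (increasing t (trans ba≡ t≡))

  placed-arc : ∀ rs {p d} → (p , d) ∈ placements rs → ∀ s → tileArc d p s ∈ arcList rs
  placed-arc rs pd∈ s = ∈-concatMap⁺ tileArcs {xs = placements rs} (Any.map (λ { refl → ∈-map⁺ (tileArc _ _) (side∈sides s) }) pd∈)

  newest-arc : ∀ e rs s → tileArc e (corner (e ∷ rs)) s ∈ arcList (e ∷ rs)
  newest-arc e rs s = arcList-∷⁺ʳ e rs (∈-map⁺ (tileArc e (corner (e ∷ rs))) (side∈sides s))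

  -- the only side of the newest tile between older vertices is its back side, already oriented as a front side
  newest-arc-older : ∀ e rs {u v} → (u , v) ∈ tileArcs (corner (e ∷ rs) , e) →
                     u ∈ vertexList rs → v ∈ vertexList rs → (u , v) ∈ arcList rs
  newest-arc-older e rs a∈ with tileArcs⁻ (corner (e ∷ rs)) e a∈
  ... | s , refl = by-cases e s
    where
      front : ∀ s → tileArc (proj₁ (tileCorners⁻ rs (corner∈tileCorners rs))) (corner rs) s ∈ arcList rs
      front = placed-arc rs (proj₂ (tileCorners⁻ rs (corner∈tileCorners rs)))
      by-cases : ∀ e s → proj₁ (tileArc e (corner (e ∷ rs)) s) ∈ vertexList rs → proj₂ (tileArc e (corner (e ∷ rs)) s) ∈ vertexList rs →
                 tileArc e (corner (e ∷ rs)) s ∈ arcList rs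
      by-cases right bot _  v∈ = ⊥-elim (U-fresh right rs v∈)
      by-cases right rgt u∈ _  = ⊥-elim (U-fresh right rs u∈)
      by-cases right top u∈ _  = ⊥-elim (W-fresh right rs u∈)
      by-cases right lft _  _  = front rgt
      by-cases up    bot _  _  = front top
      by-cases up    rgt _  v∈ = ⊥-elim (W-fresh up rs v∈)
      by-cases up    top u∈ _  = ⊥-elim (W-fresh up rs u∈)
      by-cases up    lft u∈ _  = ⊥-elim (U-fresh up rs u∈)

  arcList-antisymmetric : ∀ rs → Antisymmetric (arcList rs)
  arcList-antisymmetric [] uv∈ vu∈ = tileArcs-antisymmetric (0 , 0) right (strip uv∈) (strip vu∈)
    where
      strip : ∀ {a} → a ∈ arcList [] → a ∈ tileArcs ((0 , 0) , right)
      strip {a} a∈ = subst (a ∈_) (Listₚ.++-identityʳ (tileArcs ((0 , 0) , right))) a∈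
  arcList-antisymmetric (e ∷ rs) uv∈ vu∈ with arcList-∷⁻ e rs uv∈ | arcList-∷⁻ e rs vu∈
  ... | inj₁ uv | inj₁ vu = arcList-antisymmetric rs uv vu
  ... | inj₁ uv | inj₂ vu = arcList-antisymmetric rs uv (newest-arc-older e rs vu (proj₂ (ends uv)) (proj₁ (ends uv)))
    where ends = arcList-endpoints rs
  ... | inj₂ uv | inj₁ vu = arcList-antisymmetric rs (newest-arc-older e rs uv (proj₂ (ends vu)) (proj₁ (ends vu))) vu
    where ends = arcList-endpoints rs
  ... | inj₂ uv | inj₂ vu = tileArcs-antisymmetric _ e uv vu

  Adjacent : List Arc → Point → Point → Set
  Adjacent A v y = (v , y) ∈ A ⊎ (y , v) ∈ A

  private
    side-neighbour : ∀ p s {a b} → (a , b) ≡ seg p s ⊎ (b , a) ≡ seg p s →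
                     b ∈ corners p × (level b ≡ suc (level a) ⊎ level a ≡ suc (level b))
    side-neighbour p s (inj₁ refl) = seg-endpoints p s (there (here refl)) , inj₁ (seg-level p s)
    side-neighbour p s (inj₂ refl) = seg-endpoints p s (here refl) , inj₂ (seg-level p s)

  tile-neighbour : ∀ p d {v y} → Adjacent (tileArcs (p , d)) v y →
                   y ∈ corners p × (level y ≡ suc (level v) ⊎ level v ≡ suc (level y))
  tile-neighbour p d (inj₁ a∈) with tileArcs⁻ p d a∈
  ... | s , eq = side-neighbour p s (Sum.map (trans eq) (cong flipArc ∘ trans eq) (tileArc-seg d p s))
  tile-neighbour p d (inj₂ a∈) with tileArcs⁻ p d a∈
  ... | s , eq = side-neighbour p s (Sum.swap (Sum.map (trans eq) (cong flipArc ∘ trans eq) (tileArc-seg d p s)))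

  bEntry-reversed : ∀ {A u v} → Antisymmetric A → (v , u) ∈ A → bEntry A u v ≡ -1ℤ
  bEntry-reversed antisym vu∈ = bEntry-backward (λ uv∈ → antisym uv∈ vu∈) vu∈

  arcMatrix : List Dir → Point → Point → ℤ
  arcMatrix rs = bEntry (arcList rs)

  dirSign : Dir → ℤ
  dirSign right = 1ℤ
  dirSign up    = -1ℤ

  arcMatrix-skew : ∀ rs u v → arcMatrix rs u v ≡ - arcMatrix rs v u
  arcMatrix-skew rs = bEntry-skew (arcList-antisymmetric rs)

  arcMatrix-older : ∀ e rs {u v} → u ∈ vertexList rs → v ∈ vertexList rs → arcMatrix (e ∷ rs) u v ≡ arcMatrix rs u v
  arcMatrix-older e rs u∈ v∈ = bEntry-cong (mk⇔ (older u∈ v∈) (arcList-∷⁺ˡ e rs)) (mk⇔ (older v∈ u∈) (arcList-∷⁺ˡ e rs))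
    where
      older : ∀ {u v} → u ∈ vertexList rs → v ∈ vertexList rs → (u , v) ∈ arcList (e ∷ rs) → (u , v) ∈ arcList rs
      older u∈ v∈ a∈ with arcList-∷⁻ e rs a∈
      ... | inj₁ a∈′ = a∈′
      ... | inj₂ a∈′ = newest-arc-older e rs a∈′ u∈ v∈

  private
    fresh-neighbour : ∀ e rs {v y} → Adjacent (arcList (e ∷ rs)) v y → v ∉ vertexList rs →
                      y ∈ corners (corner (e ∷ rs)) × (level y ≡ suc (level v) ⊎ level v ≡ suc (level y))
    fresh-neighbour e rs (inj₁ a∈) v∉ with arcList-∷⁻ e rs a∈
    ... | inj₁ old = ⊥-elim (v∉ (proj₁ (arcList-endpoints rs old)))
    ... | inj₂ new = tile-neighbour _ e (inj₁ new)
    fresh-neighbour e rs (inj₂ a∈) v∉ with arcList-∷⁻ e rs a∈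
    ... | inj₁ old = ⊥-elim (v∉ (proj₂ (arcList-endpoints rs old)))
    ... | inj₂ new = tile-neighbour _ e (inj₂ new)

  arcMatrix-U-sparse : ∀ e rs {y} → y ∈ vertexList rs → y ≢ corner (e ∷ rs) → arcMatrix (e ∷ rs) (U (e ∷ rs)) y ≡ 0ℤ
  arcMatrix-U-sparse e rs {y} y∈ y≢q = bEntry-none (not-adjacent ∘ inj₁) (not-adjacent ∘ inj₂)
    where
      not-adjacent : Adjacent (arcList (e ∷ rs)) (U (e ∷ rs)) y → ⊥
      not-adjacent adj with fresh-neighbour e rs adj (U-fresh e rs)
      ... | _   , inj₁ above = ℕₚ.1+n≰n (subst (_≤ 2 + length rs) (trans above (cong suc (level-U (e ∷ rs)))) (vertexList-level rs y∈))
      ... | y∈c , inj₂ below = y≢q (corners-bottom _ y∈c (ℕₚ.suc-injective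
                                 (trans (sym below) (trans (level-U (e ∷ rs)) (cong suc (sym (level-corner (e ∷ rs))))))))

  arcMatrix-W-sparse : ∀ e rs {y} → y ∈ vertexList rs → y ≢ W rs → arcMatrix (e ∷ rs) (W (e ∷ rs)) y ≡ 0ℤ
  arcMatrix-W-sparse e rs {y} y∈ y≢W = bEntry-none (not-adjacent ∘ inj₁) (not-adjacent ∘ inj₂)
    where
      not-adjacent : Adjacent (arcList (e ∷ rs)) (W (e ∷ rs)) y → ⊥
      not-adjacent adj with fresh-neighbour e rs adj (W-fresh e rs)
      ... | _ , inj₁ above = ℕₚ.1+n≰n (ℕₚ.≤-trans (ℕₚ.n≤1+n _)
                               (subst (_≤ 2 + length rs) (trans above (cong suc (level-W (e ∷ rs)))) (vertexList-level rs y∈)))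
      ... | _ , inj₂ below = y≢W (vertexList-top rs y∈ (ℕₚ.suc-injective (trans (sym below) (level-W (e ∷ rs)))))

  arcMatrix-U-W : ∀ e rs → arcMatrix (e ∷ rs) (U (e ∷ rs)) (W (e ∷ rs)) ≡ dirSign e
  arcMatrix-U-W right rs = bEntry-forward (newest-arc right rs rgt)
  arcMatrix-U-W up    rs = bEntry-reversed (arcList-antisymmetric (up ∷ rs)) (newest-arc up rs top)

  arcMatrix-U-corner : ∀ e rs → arcMatrix (e ∷ rs) (U (e ∷ rs)) (corner (e ∷ rs)) ≡ - dirSign e
  arcMatrix-U-corner right rs = bEntry-reversed (arcList-antisymmetric (right ∷ rs)) (newest-arc right rs bot)
  arcMatrix-U-corner up    rs = bEntry-forward (newest-arc up rs lft)

  arcMatrix-W-W : ∀ e rs → arcMatrix (e ∷ rs) (W (e ∷ rs)) (W rs) ≡ dirSign e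
  arcMatrix-W-W right rs = bEntry-forward (newest-arc right rs top)
  arcMatrix-W-W up    rs = bEntry-reversed (arcList-antisymmetric (up ∷ rs)) (newest-arc up rs rgt)

module Recurrences where

  open Pfaffians using (pfaffian; pfaffian-cong; pfaffian-sparse-row; pfaffian-map; ∣pfaffian∣-↭; pff≡pfaffian)
  open FactorCounts using (Attachment; factorCount; allBut; factorCount-cong; factorCount-↭;
                           factorCount-attach; factorCount-attach-without-uw; factorCount-attach-without-bw)
  open SnakeGraphs
  open import Data.Nat as ℕ using (ℕ)
  import Data.Nat.Properties as ℕₚ
  open import Data.Integer as ℤ using (ℤ; +_; -_; _+_; _-_; _*_; ∣_∣)
  import Data.Integer.Properties as ℤₚ
  open import Data.Integer.Tactic.RingSolver using (solve-∀)
  open import Data.List using (List; []; _∷_; map; length; upTo; applyUpTo; reverse)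
  import Data.List.Properties as Listₚ
  open import Data.List.Membership.Propositional using (_∈_)
  open import Data.List.Relation.Unary.Any using (here; there)
  open import Data.List.Relation.Unary.All as All using (All; _∷_)
  open import Data.List.Relation.Unary.AllPairs using (_∷_)
  open import Data.List.Relation.Unary.Unique.Propositional using (Unique)
  open import Data.Product using (_×_; _,_)
  open import Data.Sum using (_⊎_; inj₁; inj₂)
  open import Function using (_∘_; id; const)
  open import Relation.Binary.PropositionalEquality

  older oldest : List Dir → List Point
  older []       = (0 , 0) ∷ (0 , 1) ∷ []
  older (e ∷ rs) = vertexList rs
  oldest []       = []
  oldest (e ∷ rs) = older rs

  -- U₋ and W₋ are the two vertices contributed by the previous tile
  U₋ W₋ : List Dir → Point
  U₋ []       = (0 , 0)
  U₋ (e ∷ rs) = U rs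
  W₋ []       = (0 , 1)
  W₋ (e ∷ rs) = W rs

  olderEdges : List Dir → List Seg
  olderEdges []       = seg (0 , 0) lft ∷ []
  olderEdges (e ∷ rs) = edgeList rs

  vertexList-older : ∀ rs → vertexList rs ≡ U rs ∷ W rs ∷ older rs
  vertexList-older []       = refl
  vertexList-older (e ∷ rs) = refl

  edgeList-older : ∀ rs → edgeList rs ≡ (U rs , W rs) ∷ (corner rs , U rs) ∷ (W₋ rs , W rs) ∷ olderEdges rs
  edgeList-older []           = refl
  edgeList-older (right ∷ rs) = refl
  edgeList-older (up ∷ rs)    = refl

  vertexList-oldest : ∀ rs → vertexList rs ≡ U rs ∷ W rs ∷ U₋ rs ∷ W₋ rs ∷ oldest rs
  vertexList-oldest []           = refl
  vertexList-oldest (e ∷ [])     = refl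
  vertexList-oldest (e ∷ d ∷ rs) = refl

  older-oldest : ∀ rs → older rs ≡ U₋ rs ∷ W₋ rs ∷ oldest rs
  older-oldest []           = refl
  older-oldest (e ∷ [])     = refl
  older-oldest (e ∷ d ∷ rs) = refl

  -- the newest tile either continues in the direction of its predecessor or turns
  continuation : ∀ e rs → (corner (e ∷ rs) ≡ U rs × lastDir rs ≡ e) ⊎ (corner (e ∷ rs) ≡ W₋ rs × dirSign (lastDir rs) ≡ - dirSign e)
  continuation right []          = inj₁ (refl , refl)
  continuation up    []          = inj₂ (refl , refl)
  continuation right (right ∷ _) = inj₁ (refl , refl)
  continuation up    (up ∷ _)    = inj₁ (refl , refl)
  continuation right (up ∷ _)    = inj₂ (refl , refl)
  continuation up    (right ∷ _) = inj₂ (refl , refl)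

  -- the Pfaffians of the whole graph, of the graph before the newest tile and of the graph
  -- without W and W₋; M, M₋ and Mʷ count the perfect matchings of the same three graphs
  P P₋ Pʷ : List Dir → ℤ
  P  rs = pfaffian (arcMatrix rs) (vertexList rs)
  P₋ rs = pfaffian (arcMatrix rs) (older rs)
  Pʷ rs = pfaffian (arcMatrix rs) (U rs ∷ U₋ rs ∷ oldest rs)

  module _ (e : Dir) (rs : List Dir) where

    private
      C = arcMatrix (e ∷ rs)
      U′ = U (e ∷ rs)
      W′ = W (e ∷ rs)
      q = corner (e ∷ rs)
      x₀ = U rs
      x₁ = W rs
      x₂ = U₋ rs
      x₃ = W₋ rs
      R = oldest rs

      ∈V : ∀ {y} → y ∈ x₀ ∷ x₁ ∷ x₂ ∷ x₃ ∷ R → y ∈ vertexList rs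
      ∈V = subst (_ ∈_) (sym (vertexList-oldest rs))

      distinct : Unique (x₀ ∷ x₁ ∷ x₂ ∷ x₃ ∷ R)
      distinct = subst Unique (vertexList-oldest rs) (vertexList-unique rs)

      x₀≢ : All (x₀ ≢_) (x₁ ∷ x₂ ∷ x₃ ∷ R)
      x₀≢ with distinct
      ... | d ∷ _ = d

      x₁≢ : All (x₁ ≢_) (x₂ ∷ x₃ ∷ R)
      x₁≢ with distinct
      ... | _ ∷ d ∷ _ = d

      x₂≢ : All (x₂ ≢_) (x₃ ∷ R)
      x₂≢ with distinct
      ... | _ ∷ _ ∷ d ∷ _ = d

      x₃≢ : All (x₃ ≢_) R
      x₃≢ with distinct
      ... | _ ∷ _ ∷ _ ∷ d ∷ _ = d

      older-entries : ∀ L → (∀ {y} → y ∈ L → y ∈ vertexList rs) → pfaffian C L ≡ pfaffian (arcMatrix rs) L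
      older-entries L ⊆V = pfaffian-cong L (λ x∈ y∈ → arcMatrix-older e rs (⊆V x∈) (⊆V y∈))

      U-zero : ∀ {y} → y ∈ x₀ ∷ x₁ ∷ x₂ ∷ x₃ ∷ R → y ≢ q → C U′ y ≡ + 0
      U-zero y∈ = arcMatrix-U-sparse e rs (∈V y∈)

      W-zero : ∀ {y} → y ∈ x₀ ∷ x₁ ∷ x₂ ∷ x₃ ∷ R → y ≢ x₁ → C W′ y ≡ + 0
      W-zero y∈ = arcMatrix-W-sparse e rs (∈V y∈)

      sym≢ : ∀ {a b : Point} → a ≢ b → b ≢ a
      sym≢ a≢b = a≢b ∘ sym

      P-rs : pfaffian C (x₀ ∷ x₁ ∷ x₂ ∷ x₃ ∷ R) ≡ P rs
      P-rs = trans (older-entries _ ∈V) (cong (pfaffian (arcMatrix rs)) (sym (vertexList-oldest rs)))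

      P₋-rs : pfaffian C (x₂ ∷ x₃ ∷ R) ≡ P₋ rs
      P₋-rs = trans (older-entries _ (∈V ∘ there ∘ there)) (cong (pfaffian (arcMatrix rs)) (sym (older-oldest rs)))

      Pʷ-rs : pfaffian C (x₀ ∷ x₂ ∷ R) ≡ Pʷ rs
      Pʷ-rs = older-entries _ λ { (here refl) → ∈V (here refl) ; (there (here refl)) → ∈V (there (there (here refl)))
                                ; (there (there y∈)) → ∈V (there (there (there (there y∈)))) }

      ∈R : ∀ {y} → y ∈ R → y ∈ x₀ ∷ x₁ ∷ x₂ ∷ x₃ ∷ R
      ∈R = there ∘ there ∘ there ∘ there

      W-row-turn : pfaffian C (W′ ∷ x₀ ∷ x₁ ∷ x₂ ∷ R) ≡ - (C W′ x₁ * Pʷ rs)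
      W-row-turn = begin
          pfaffian C (W′ ∷ x₀ ∷ x₁ ∷ x₂ ∷ R)
        ≡⟨ pfaffian-sparse-row C W′ (x₀ ∷ x₁ ∷ []) (x₂ ∷ R)
             (λ { (here refl) → W-zero (there (there (here refl))) (sym≢ (All.lookup x₁≢ (here refl)))
                ; (there y∈) → W-zero (∈R y∈) (sym≢ (All.lookup x₁≢ (there (there y∈)))) }) ⟩
          C W′ x₀ * pfaffian C (x₁ ∷ x₂ ∷ R) - (C W′ x₁ * pfaffian C (x₀ ∷ x₂ ∷ R) - + 0)
        ≡⟨ cong₂ (λ a b → a * pfaffian C (x₁ ∷ x₂ ∷ R) - (C W′ x₁ * b - + 0))
             (W-zero (here refl) (All.lookup x₀≢ (here refl))) Pʷ-rs ⟩
          + 0 * pfaffian C (x₁ ∷ x₂ ∷ R) - (C W′ x₁ * Pʷ rs - + 0)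
        ≡⟨ lemma (pfaffian C (x₁ ∷ x₂ ∷ R)) (C W′ x₁) (Pʷ rs) ⟩
          - (C W′ x₁ * Pʷ rs)
        ∎
        where
          open ≡-Reasoning
          lemma : ∀ p b p′ → + 0 * p - (b * p′ - + 0) ≡ - (b * p′)
          lemma = solve-∀

    P₋-∷ : P₋ (e ∷ rs) ≡ P rs
    P₋-∷ = older-entries (vertexList rs) (λ y∈ → y∈)

    P-∷-straight : q ≡ x₀ → P (e ∷ rs) ≡ C U′ W′ * P rs - C U′ x₀ * (C W′ x₁ * P₋ rs)
    P-∷-straight q≡x₀ = begin
        pfaffian C (U′ ∷ W′ ∷ vertexList rs)
      ≡⟨ cong (λ L → pfaffian C (U′ ∷ W′ ∷ L)) (vertexList-oldest rs) ⟩
        pfaffian C (U′ ∷ W′ ∷ x₀ ∷ x₁ ∷ x₂ ∷ x₃ ∷ R)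
      ≡⟨ pfaffian-sparse-row C U′ (W′ ∷ x₀ ∷ []) (x₁ ∷ x₂ ∷ x₃ ∷ R)
           (λ y∈ → U-zero (there y∈) (λ y≡q → All.lookup x₀≢ y∈ (trans (sym q≡x₀) (sym y≡q)))) ⟩
        C U′ W′ * pfaffian C (x₀ ∷ x₁ ∷ x₂ ∷ x₃ ∷ R) - (C U′ x₀ * pfaffian C (W′ ∷ x₁ ∷ x₂ ∷ x₃ ∷ R) - + 0)
      ≡⟨ cong₂ (λ a b → C U′ W′ * a - (C U′ x₀ * b - + 0)) P-rs
           (pfaffian-sparse-row C W′ (x₁ ∷ []) (x₂ ∷ x₃ ∷ R) (λ y∈ → W-zero (there (there y∈)) (sym≢ (All.lookup x₁≢ y∈)))) ⟩
        C U′ W′ * P rs - (C U′ x₀ * (C W′ x₁ * pfaffian C (x₂ ∷ x₃ ∷ R) - + 0) - + 0)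
      ≡⟨ cong (λ a → C U′ W′ * P rs - (C U′ x₀ * (C W′ x₁ * a - + 0) - + 0)) P₋-rs ⟩
        C U′ W′ * P rs - (C U′ x₀ * (C W′ x₁ * P₋ rs - + 0) - + 0)
      ≡⟨ lemma (C U′ W′) (P rs) (C U′ x₀) (C W′ x₁) (P₋ rs) ⟩
        C U′ W′ * P rs - C U′ x₀ * (C W′ x₁ * P₋ rs)
      ∎
      where
        open ≡-Reasoning
        lemma : ∀ a p b c p₋ → a * p - (b * (c * p₋ - + 0) - + 0) ≡ a * p - b * (c * p₋)
        lemma = solve-∀

    P-∷-turn : q ≡ x₃ → P (e ∷ rs) ≡ C U′ W′ * P rs + C U′ x₃ * - (C W′ x₁ * Pʷ rs)
    P-∷-turn q≡x₃ = begin
        pfaffian C (U′ ∷ W′ ∷ vertexList rs)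
      ≡⟨ cong (λ L → pfaffian C (U′ ∷ W′ ∷ L)) (vertexList-oldest rs) ⟩
        pfaffian C (U′ ∷ W′ ∷ x₀ ∷ x₁ ∷ x₂ ∷ x₃ ∷ R)
      ≡⟨ pfaffian-sparse-row C U′ (W′ ∷ x₀ ∷ x₁ ∷ x₂ ∷ x₃ ∷ []) R (λ y∈ → U-zero (∈R y∈) (not-q (All.lookup x₃≢ y∈))) ⟩
        C U′ W′ * pfaffian C (x₀ ∷ x₁ ∷ x₂ ∷ x₃ ∷ R)
          - (C U′ x₀ * pfaffian C (W′ ∷ x₁ ∷ x₂ ∷ x₃ ∷ R) - (C U′ x₁ * pfaffian C (W′ ∷ x₀ ∷ x₂ ∷ x₃ ∷ R)
          - (C U′ x₂ * pfaffian C (W′ ∷ x₀ ∷ x₁ ∷ x₃ ∷ R) - (C U′ x₃ * pfaffian C (W′ ∷ x₀ ∷ x₁ ∷ x₂ ∷ R) - + 0))))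
      ≡⟨ drop-zeros (U-zero (here refl) (not-q (sym≢ (All.lookup x₀≢ (there (there (here refl)))))))
                    (U-zero (there (here refl)) (not-q (sym≢ (All.lookup x₁≢ (there (here refl))))))
                    (U-zero (there (there (here refl))) (not-q (sym≢ (All.lookup x₂≢ (here refl)))))
                    (C U′ W′) (pfaffian C (x₀ ∷ x₁ ∷ x₂ ∷ x₃ ∷ R)) (pfaffian C (W′ ∷ x₁ ∷ x₂ ∷ x₃ ∷ R))
                    (pfaffian C (W′ ∷ x₀ ∷ x₂ ∷ x₃ ∷ R)) (pfaffian C (W′ ∷ x₀ ∷ x₁ ∷ x₃ ∷ R))
                    (C U′ x₃) (pfaffian C (W′ ∷ x₀ ∷ x₁ ∷ x₂ ∷ R)) ⟩
        C U′ W′ * pfaffian C (x₀ ∷ x₁ ∷ x₂ ∷ x₃ ∷ R) + C U′ x₃ * pfaffian C (W′ ∷ x₀ ∷ x₁ ∷ x₂ ∷ R)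
      ≡⟨ cong₂ (λ a b → C U′ W′ * a + C U′ x₃ * b) P-rs W-row-turn ⟩
        C U′ W′ * P rs + C U′ x₃ * - (C W′ x₁ * Pʷ rs)
      ∎
      where
        open ≡-Reasoning
        not-q : ∀ {y} → x₃ ≢ y → y ≢ q
        not-q x₃≢y y≡q = x₃≢y (trans (sym q≡x₃) (sym y≡q))
        drop-zeros : ∀ {b₀ b₁ b₂} → b₀ ≡ + 0 → b₁ ≡ + 0 → b₂ ≡ + 0 → ∀ a p p₀ p₁ p₂ b₃ p₃ →
                     a * p - (b₀ * p₀ - (b₁ * p₁ - (b₂ * p₂ - (b₃ * p₃ - + 0)))) ≡ a * p + b₃ * p₃
        drop-zeros refl refl refl = lemma
          where
            lemma : ∀ a p p₀ p₁ p₂ b₃ p₃ → a * p - (+ 0 * p₀ - (+ 0 * p₁ - (+ 0 * p₂ - (b₃ * p₃ - + 0)))) ≡ a * p + b₃ * p₃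
            lemma = solve-∀
    Pʷ-∷-straight : q ≡ x₀ → Pʷ (e ∷ rs) ≡ C U′ x₀ * P₋ rs
    Pʷ-∷-straight q≡x₀ = begin
        pfaffian C (U′ ∷ x₀ ∷ older rs)
      ≡⟨ cong (λ L → pfaffian C (U′ ∷ x₀ ∷ L)) (older-oldest rs) ⟩
        pfaffian C (U′ ∷ x₀ ∷ x₂ ∷ x₃ ∷ R)
      ≡⟨ pfaffian-sparse-row C U′ (x₀ ∷ []) (x₂ ∷ x₃ ∷ R)
           (λ y∈ → U-zero (there (there y∈)) (λ y≡q → All.lookup x₀≢ (there y∈) (trans (sym q≡x₀) (sym y≡q)))) ⟩
        C U′ x₀ * pfaffian C (x₂ ∷ x₃ ∷ R) - + 0
      ≡⟨ ℤₚ.+-identityʳ _ ⟩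
        C U′ x₀ * pfaffian C (x₂ ∷ x₃ ∷ R)
      ≡⟨ cong (C U′ x₀ *_) P₋-rs ⟩
        C U′ x₀ * P₋ rs
      ∎
      where open ≡-Reasoning

    Pʷ-∷-turn : q ≡ x₃ → Pʷ (e ∷ rs) ≡ C U′ x₃ * Pʷ rs
    Pʷ-∷-turn q≡x₃ = begin
        pfaffian C (U′ ∷ x₀ ∷ older rs)
      ≡⟨ cong (λ L → pfaffian C (U′ ∷ x₀ ∷ L)) (older-oldest rs) ⟩
        pfaffian C (U′ ∷ x₀ ∷ x₂ ∷ x₃ ∷ R)
      ≡⟨ pfaffian-sparse-row C U′ (x₀ ∷ x₂ ∷ x₃ ∷ []) R
           (λ y∈ → U-zero (there (there (there (there y∈)))) (not-q (All.lookup x₃≢ y∈))) ⟩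
        C U′ x₀ * pfaffian C (x₂ ∷ x₃ ∷ R) - (C U′ x₂ * pfaffian C (x₀ ∷ x₃ ∷ R) - (C U′ x₃ * pfaffian C (x₀ ∷ x₂ ∷ R) - + 0))
      ≡⟨ cong₂ (λ a b → a * pfaffian C (x₂ ∷ x₃ ∷ R) - (b * pfaffian C (x₀ ∷ x₃ ∷ R) - (C U′ x₃ * pfaffian C (x₀ ∷ x₂ ∷ R) - + 0)))
           (U-zero (here refl) (not-q (sym≢ (All.lookup x₀≢ (there (there (here refl)))))))
           (U-zero (there (there (here refl))) (not-q (sym≢ (All.lookup x₂≢ (here refl))))) ⟩
        + 0 * pfaffian C (x₂ ∷ x₃ ∷ R) - (+ 0 * pfaffian C (x₀ ∷ x₃ ∷ R) - (C U′ x₃ * pfaffian C (x₀ ∷ x₂ ∷ R) - + 0))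
      ≡⟨ lemma (pfaffian C (x₂ ∷ x₃ ∷ R)) (pfaffian C (x₀ ∷ x₃ ∷ R)) (C U′ x₃) (pfaffian C (x₀ ∷ x₂ ∷ R)) ⟩
        C U′ x₃ * pfaffian C (x₀ ∷ x₂ ∷ R)
      ≡⟨ cong (C U′ x₃ *_) Pʷ-rs ⟩
        C U′ x₃ * Pʷ rs
      ∎
      where
        open ≡-Reasoning
        not-q : ∀ {y} → x₃ ≢ y → y ≢ q
        not-q x₃≢y y≡q = x₃≢y (trans (sym q≡x₃) (sym y≡q))
        lemma : ∀ p₀ p₂ b p → + 0 * p₀ - (+ 0 * p₂ - (b * p - + 0)) ≡ b * p
        lemma = solve-∀

  attachment : ∀ rs → Attachment (U rs) (W rs) (corner rs) (W₋ rs) (older rs) (olderEdges rs)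
  attachment [] = record
    { u∉V  = λ { (here ()) ; (there (here ())) ; (there (there ())) }
    ; w∉V  = λ { (here ()) ; (there (here ())) ; (there (there ())) }
    ; u≢w  = λ ()
    ; a∈V  = here refl
    ; b∈V  = there (here refl)
    ; a≢b  = λ ()
    ; E⊆V² = λ { (here refl) → here refl , there (here refl) ; (there ()) }
    }
  attachment (e ∷ rs) = record
    { u∉V  = U-fresh e rs
    ; w∉V  = W-fresh e rs
    ; u≢w  = U≢W (e ∷ rs)
    ; a∈V  = corner∈ (continuation e rs)
    ; b∈V  = subst (W rs ∈_) (sym (vertexList-oldest rs)) (there (here refl))
    ; a≢b  = λ q≡W → ℕₚ.1+n≢n (trans (sym (level-W rs)) (trans (cong level (sym q≡W)) (level-corner (e ∷ rs))))
    ; E⊆V² = edgeList-endpoints rs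
    }
    where
      corner∈ : _ → corner (e ∷ rs) ∈ vertexList rs
      corner∈ (inj₁ (q≡U , _)) = subst (_∈ vertexList rs) (sym q≡U) (subst (U rs ∈_) (sym (vertexList-oldest rs)) (here refl))
      corner∈ (inj₂ (q≡W₋ , _)) =
        subst (_∈ vertexList rs) (sym q≡W₋) (subst (W₋ rs ∈_) (sym (vertexList-oldest rs)) (there (there (there (here refl)))))

  M M₋ Mʷ : List Dir → ℕ
  M  rs = factorCount (edgeList rs) (vertexList rs) (const 1)
  M₋ rs = factorCount (olderEdges rs) (older rs) (const 1)
  Mʷ rs = factorCount (edgeList rs) (vertexList rs) (allBut (W₋ rs) (W rs))

  module _ (e : Dir) (rs : List Dir) where

    private
      without-back : ℕ
      without-back = factorCount (edgeList rs) (vertexList rs) (allBut (corner (e ∷ rs)) (W rs))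

      by-shape : ∀ f → factorCount (edgeList (e ∷ rs)) (vertexList (e ∷ rs)) f
                     ≡ factorCount ((U (e ∷ rs) , W (e ∷ rs)) ∷ (corner (e ∷ rs) , U (e ∷ rs)) ∷ (W rs , W (e ∷ rs)) ∷ edgeList rs)
                                   (vertexList (e ∷ rs)) f
      by-shape f = cong (λ E → factorCount E (vertexList (e ∷ rs)) f) (edgeList-older (e ∷ rs))

    M-∷ : M (e ∷ rs) ≡ M rs ℕ.+ without-back
    M-∷ = trans (by-shape (const 1)) (factorCount-attach (attachment (e ∷ rs)))

    Mʷ-∷ : Mʷ (e ∷ rs) ≡ without-back
    Mʷ-∷ = trans (by-shape (allBut (W rs) (W (e ∷ rs)))) (factorCount-attach-without-bw (attachment (e ∷ rs)))

    without-back-straight : corner (e ∷ rs) ≡ U rs → without-back ≡ M₋ rs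
    without-back-straight q≡U = begin
        factorCount (edgeList rs) (vertexList rs) (allBut (corner (e ∷ rs)) (W rs))
      ≡⟨ cong₃ q≡U (edgeList-older rs) (vertexList-older rs) ⟩
        factorCount ((U rs , W rs) ∷ (corner rs , U rs) ∷ (W₋ rs , W rs) ∷ olderEdges rs) (U rs ∷ W rs ∷ older rs) (allBut (U rs) (W rs))
      ≡⟨ factorCount-attach-without-uw (attachment rs) ⟩
        M₋ rs
      ∎
      where
        open ≡-Reasoning
        cong₃ : ∀ {a b E E′ V V′} → a ≡ b → E ≡ E′ → V ≡ V′ → factorCount E V (allBut a (W rs)) ≡ factorCount E′ V′ (allBut b (W rs))
        cong₃ refl refl refl = refl

    without-back-turn : corner (e ∷ rs) ≡ W₋ rs → without-back ≡ Mʷ rs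
    without-back-turn q≡W₋ = cong (λ a → factorCount (edgeList rs) (vertexList rs) (allBut a (W rs))) q≡W₋

  snakeSign : List Dir → ℤ
  snakeSign []       = + 1
  snakeSign (e ∷ rs) = dirSign e * snakeSign rs

  ∣snakeSign∣ : ∀ rs → ℤ.∣ snakeSign rs ∣ ≡ 1
  ∣snakeSign∣ []       = refl
  ∣snakeSign∣ (e ∷ rs) = trans (ℤₚ.abs-* (dirSign e) (snakeSign rs)) (trans (cong (ℤ.∣ dirSign e ∣ ℕ.*_) (∣snakeSign∣ rs)) (unit e))
    where
      unit : ∀ e → ℤ.∣ dirSign e ∣ ℕ.* 1 ≡ 1
      unit right = refl
      unit up    = refl

  record PfaffianCounts (rs : List Dir) : Set where
    field
      whole   : P rs ≡ snakeSign rs * + M rs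
      withoutUW : P₋ rs ≡ dirSign (lastDir rs) * snakeSign rs * + M₋ rs
      withoutW  : Pʷ rs ≡ - dirSign (lastDir rs) * snakeSign rs * + Mʷ rs

  private
    straight-sign : ∀ e σ m m₋ → dirSign e * (σ * m) - (- dirSign e) * (dirSign e * (dirSign e * σ * m₋)) ≡ dirSign e * σ * (m + m₋)
    straight-sign right = solve-∀
    straight-sign up    = solve-∀

    turn-sign : ∀ e σ m mʷ → dirSign e * (σ * m) + (- dirSign e) * - (dirSign e * (- (- dirSign e) * σ * mʷ)) ≡ dirSign e * σ * (m + mʷ)
    turn-sign right = solve-∀
    turn-sign up    = solve-∀

    unit-sign : ∀ e σ m → σ * m ≡ dirSign e * (dirSign e * σ) * m
    unit-sign right = solve-∀
    unit-sign up    = solve-∀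

    scale-sign : ∀ d σ m → (- d) * (d * σ * m) ≡ - d * (d * σ) * m
    scale-sign = solve-∀

    turn-scale-sign : ∀ d σ m → (- d) * (- (- d) * σ * m) ≡ - d * (d * σ) * m
    turn-scale-sign = solve-∀

  module _ (e : Dir) (rs : List Dir) (ih : PfaffianCounts rs) where
    open PfaffianCounts ih
    private
      C = arcMatrix (e ∷ rs)
      U′ = U (e ∷ rs)
      W′ = W (e ∷ rs)
      d = dirSign e
      σ = snakeSign rs

    pfaffianCounts-straight : corner (e ∷ rs) ≡ U rs → lastDir rs ≡ e → PfaffianCounts (e ∷ rs)
    pfaffianCounts-straight q≡U refl = record
      { whole = begin
          P (e ∷ rs)
        ≡⟨ P-∷-straight e rs q≡U ⟩
          C U′ W′ * P rs - C U′ (U rs) * (C W′ (W rs) * P₋ rs)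
        ≡⟨ cong₂ (λ a b → a * P rs - b) (arcMatrix-U-W e rs) (cong₂ _*_ U-corner (cong₂ _*_ (arcMatrix-W-W e rs) withoutUW)) ⟩
          d * P rs - (- d) * (d * (d * σ * + M₋ rs))
        ≡⟨ cong (λ p → d * p - (- d) * (d * (d * σ * + M₋ rs))) whole ⟩
          d * (σ * + M rs) - (- d) * (d * (d * σ * + M₋ rs))
        ≡⟨ straight-sign e σ (+ M rs) (+ M₋ rs) ⟩
          d * σ * (+ M rs + + M₋ rs)
        ≡⟨ cong (d * σ *_) (sym (trans (cong +_ M≡) (ℤₚ.pos-+ (M rs) (M₋ rs)))) ⟩
          d * σ * + M (e ∷ rs)
        ∎
      ; withoutUW = trans (P₋-∷ e rs) (trans whole (unit-sign e σ (+ M rs)))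
      ; withoutW = begin
          Pʷ (e ∷ rs)                   ≡⟨ Pʷ-∷-straight e rs q≡U ⟩
          C U′ (U rs) * P₋ rs           ≡⟨ cong₂ _*_ U-corner withoutUW ⟩
          (- d) * (d * σ * + M₋ rs)     ≡⟨ scale-sign d σ (+ M₋ rs) ⟩
          - d * (d * σ) * + M₋ rs       ≡⟨ cong (λ m → - d * (d * σ) * + m) (sym (trans (Mʷ-∷ e rs) (without-back-straight e rs q≡U))) ⟩
          - d * (d * σ) * + Mʷ (e ∷ rs) ∎
      }
      where
        open ≡-Reasoning
        U-corner : C U′ (U rs) ≡ - d
        U-corner = trans (cong (C U′) (sym q≡U)) (arcMatrix-U-corner e rs)
        M≡ : M (e ∷ rs) ≡ M rs ℕ.+ M₋ rs
        M≡ = trans (M-∷ e rs) (cong (M rs ℕ.+_) (without-back-straight e rs q≡U))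

    pfaffianCounts-turn : corner (e ∷ rs) ≡ W₋ rs → dirSign (lastDir rs) ≡ - d → PfaffianCounts (e ∷ rs)
    pfaffianCounts-turn q≡W₋ δ≡ = record
      { whole = begin
          P (e ∷ rs)
        ≡⟨ P-∷-turn e rs q≡W₋ ⟩
          C U′ W′ * P rs + C U′ (W₋ rs) * - (C W′ (W rs) * Pʷ rs)
        ≡⟨ cong₂ (λ a b → a * P rs + b) (arcMatrix-U-W e rs) (cong₂ _*_ U-corner (cong -_ (cong₂ _*_ (arcMatrix-W-W e rs) withoutW′))) ⟩
          d * P rs + (- d) * - (d * (- (- d) * σ * + Mʷ rs))
        ≡⟨ cong (λ p → d * p + (- d) * - (d * (- (- d) * σ * + Mʷ rs))) whole ⟩
          d * (σ * + M rs) + (- d) * - (d * (- (- d) * σ * + Mʷ rs))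
        ≡⟨ turn-sign e σ (+ M rs) (+ Mʷ rs) ⟩
          d * σ * (+ M rs + + Mʷ rs)
        ≡⟨ cong (d * σ *_) (sym (trans (cong +_ M≡) (ℤₚ.pos-+ (M rs) (Mʷ rs)))) ⟩
          d * σ * + M (e ∷ rs)
        ∎
      ; withoutUW = trans (P₋-∷ e rs) (trans whole (unit-sign e σ (+ M rs)))
      ; withoutW = begin
          Pʷ (e ∷ rs)                      ≡⟨ Pʷ-∷-turn e rs q≡W₋ ⟩
          C U′ (W₋ rs) * Pʷ rs             ≡⟨ cong₂ _*_ U-corner withoutW′ ⟩
          (- d) * (- (- d) * σ * + Mʷ rs)  ≡⟨ turn-scale-sign d σ (+ Mʷ rs) ⟩
          - d * (d * σ) * + Mʷ rs          ≡⟨ cong (λ m → - d * (d * σ) * + m) (sym (trans (Mʷ-∷ e rs) (without-back-turn e rs q≡W₋))) ⟩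
          - d * (d * σ) * + Mʷ (e ∷ rs)    ∎
      }
      where
        open ≡-Reasoning
        U-corner : C U′ (W₋ rs) ≡ - d
        U-corner = trans (cong (C U′) (sym q≡W₋)) (arcMatrix-U-corner e rs)
        withoutW′ : Pʷ rs ≡ - (- d) * σ * + Mʷ rs
        withoutW′ = trans withoutW (cong (λ δ → - δ * σ * + Mʷ rs) δ≡)
        M≡ : M (e ∷ rs) ≡ M rs ℕ.+ Mʷ rs
        M≡ = trans (M-∷ e rs) (cong (M rs ℕ.+_) (without-back-turn e rs q≡W₋))

  pfaffianCounts : ∀ rs → PfaffianCounts rs
  pfaffianCounts [] = record { whole = refl ; withoutUW = refl ; withoutW = refl }
  pfaffianCounts (e ∷ rs) with continuation e rs
  ... | inj₁ (q≡U , straight) = pfaffianCounts-straight e rs (pfaffianCounts rs) q≡U straight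
  ... | inj₂ (q≡W₋ , turn)    = pfaffianCounts-turn e rs (pfaffianCounts rs) q≡W₋ turn

  map-nth-upTo : ∀ (V : List Point) → map (nth V) (upTo (length V)) ≡ V
  map-nth-upTo V = trans (Listₚ.map-applyUpTo id (nth V) (length V)) (applyUpTo-nth V)
    where
      applyUpTo-nth : ∀ V → applyUpTo (nth V) (length V) ≡ V
      applyUpTo-nth []       = refl
      applyUpTo-nth (v ∷ vs) = cong (v ∷_) (applyUpTo-nth vs)

  ∣P∣≡M : ∀ rs → ∣ P rs ∣ ≡ M rs
  ∣P∣≡M rs = begin
      ∣ P rs ∣                          ≡⟨ cong ∣_∣ (PfaffianCounts.whole (pfaffianCounts rs)) ⟩
      ∣ snakeSign rs * + M rs ∣          ≡⟨ ℤₚ.abs-* (snakeSign rs) (+ M rs) ⟩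
      ∣ snakeSign rs ∣ ℕ.* M rs          ≡⟨ cong (ℕ._* M rs) (∣snakeSign∣ rs) ⟩
      1 ℕ.* M rs                        ≡⟨ ℕₚ.*-identityˡ (M rs) ⟩
      M rs                              ∎
    where open ≡-Reasoning

  theorem-reversed : ∀ rs → let G = reverse rs in ∣ pff (length (vertices G)) (B1 G) ∣ ≡ numPerfectMatchings G
  theorem-reversed rs = begin
      ∣ pff (length V) (B1 G) ∣
    ≡⟨ cong ∣_∣ (pff≡pfaffian (length V) (B1 G)) ⟩
      ∣ pfaffian (B1 G) (upTo (length V)) ∣
    ≡⟨ cong ∣_∣ (pfaffian-map (nth V) (bEntry O) (upTo (length V))) ⟨
      ∣ pfaffian (bEntry O) (map (nth V) (upTo (length V))) ∣
    ≡⟨ cong (∣_∣ ∘ pfaffian (bEntry O)) (map-nth-upTo V) ⟩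
      ∣ pfaffian (bEntry O) V ∣
    ≡⟨ cong ∣_∣ (pfaffian-cong V (λ _ _ → bEntry-orientation rs _ _)) ⟩
      ∣ pfaffian (arcMatrix rs) V ∣
    ≡⟨ ∣pfaffian∣-↭ (arcMatrix-skew rs) (vertices-↭ rs) ⟩
      ∣ P rs ∣
    ≡⟨ ∣P∣≡M rs ⟩
      M rs
    ≡⟨ factorCount-cong (edgeList rs) (vertexList⇒vertices rs) (vertices⇒vertexList rs) (λ _ → refl) ⟩
      factorCount (edgeList rs) V (const 1)
    ≡⟨ factorCount-↭ (edges-↭ rs) V (const 1) ⟨
      numPerfectMatchings G
    ∎
    where
      open ≡-Reasoning
      G = reverse rs
      V = vertices G
      O = orientation G

open Recurrences using (theorem-reversed)

mainTheorem3 : (G : SnakeGraph) → ∣ pff (length (vertices G)) (B1 G) ∣ ≡ numPerfectMatchings G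
mainTheorem3 G = subst (λ H → ∣ pff (length (vertices H)) (B1 H) ∣ ≡ numPerfectMatchings H)
                       (reverse-involutive G) (theorem-reversed (reverse G))
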